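{- Let $p\geq 11$ be a prime with $p\not\equiv \pm1 \pmod 8$. Identify the elements of $\mathrm{GF}(p)$ with the integers $\{0,1,\ldots,p-1\}$, let $S$ be the set of nonzero squares and $N$ the set of nonsquares of $\mathrm{GF}(p)$ (viewed as sets of integers). Construct a vertex-labelled rooted tree $T$ with levels $0,1,2$ as follows: level $0$ is a single vertex labelled $0$; level $1$ consists of children of this root, labelled by all elements of $N$ together with all elements $s\in S$ with $s>p/2$; level $2$ consists of vertices labelled by the elements $s\in S$ with $s<p/2$, where the vertex labelled $s$ is made a child of the level-$1$ vertex labelled $2s$ (note $2s\in N$). Then $T$ is a tree, the map sending each vertex to its label is a near $\alpha$-valuation of $T$, and $T$ admits no $\alpha$-valuation. Moreover, if $p\equiv 5\pmod 8$, then $T$ is a rooted tree whose root has $3(p-1)/4$ children, of which $(p-1)/4$ have exactly one child each (and the rest have none).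
   Context: A $\beta$-valuation (graceful labelling) of a graph $G$ with $n$ edges is an injective map $b:V(G)\to\{0,1,\ldots,n\}$ such that the multiset $\{|b(u)-b(v)| : \{u,v\}\in E(G)\}$ equals $\{1,2,\ldots,n\}$. An $\alpha$-valuation is a $\beta$-valuation $b$ for which there is an integer $x$ with $0\le x\le n$ such that every edge $\{u,v\}$ satisfies $b(u)\le x<b(v)$ or $b(v)\le x<b(u)$. A near $\alpha$-valuation is a $\beta$-valuation $b$ for which there is a partition $V(G)=V_{small}\cup V_{large}$ such that each $v\in V_{small}$ has $b(v)<b(u)$ for every neighbour $u$ of $v$, and each $v\in V_{large}$ has $b(v)>b(u)$ for every neighbour $u$ of $v$. -}

module Defs where

open import Data.Nat using (ℕ; zero; suc; _+_; _*_; _∸_; _≤_; _<_; _%_; ∣_-_∣; _≡ᵇ_; _<ᵇ_)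
open import Data.Nat.DivMod using (m%n<n)
open import Data.Bool using (Bool; true; false; if_then_else_; _∧_; _∨_; not)
open import Data.Fin using (Fin; toℕ; fromℕ<) renaming (zero to fzero)
open import Data.List using (List; []; _∷_; [_]; _++_; map; upTo; allFin; concatMap; length; filter)
open import Data.Bool.ListAction using (any)
open import Data.List.Membership.Propositional using (_∈_)
open import Data.List.Relation.Unary.All using (All)
open import Data.List.Relation.Unary.AllPairs using (AllPairs)
open import Data.List.Relation.Unary.Unique.Propositional using (Unique)
open import Data.List.Relation.Unary.Linked using (Linked)
open import Data.List.Relation.Binary.Permutation.Propositional using (_↭_)
open import Relation.Binary.Construct.Closure.ReflexiveTransitive using (Star)
open import Data.Product using (Σ; _×_; _,_; proj₁; proj₂; swap)
open import Data.Sum using (_⊎_)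
open import Data.Empty using (⊥)
open import Relation.Nullary using (¬_)
open import Relation.Binary.PropositionalEquality using (_≡_; _≢_)
open import Function.Definitions using (Injective)
import Data.Fin as F

-- Finite graphs: vertex set Fin V, edges given as a list of pairs.
-- An edge (u , v) is the unordered edge {u, v}; for rooted trees we
-- use the convention that u is the parent and v the child.

record Graph : Set where
  constructor mkGraph
  field
    V : ℕ
    E : List (Fin V × Fin V)
open Graph public

#E : Graph → ℕ
#E G = length (E G)

Adj : (G : Graph) → Fin (V G) → Fin (V G) → Set
Adj G u v = ((u , v) ∈ E G) ⊎ ((v , u) ∈ E G)

IsSimple : Graph → Set
IsSimple G = All (λ e → proj₁ e ≢ proj₂ e) (E G)
           × AllPairs (λ e f → e ≢ f × e ≢ swap f) (E G)

Connected : Graph → Set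
Connected G = ∀ u v → Star (Adj G) u v

record Cycle (G : Graph) : Set where
  field
    start  : Fin (V G)
    rest   : List (Fin (V G))
    long   : 2 ≤ length rest
    distinct : Unique (start ∷ rest)
    closed : Linked (Adj G) (start ∷ rest ++ [ start ])

Acyclic : Graph → Set
Acyclic G = ¬ Cycle G

IsTree : Graph → Set
IsTree G = IsSimple G × Connected G × Acyclic G

edgeDiffs : (G : Graph) → (Fin (V G) → ℕ) → List ℕ
edgeDiffs G b = map (λ e → ∣ b (proj₁ e) - b (proj₂ e) ∣) (E G)

IsBetaValuation : (G : Graph) → (Fin (V G) → ℕ) → Set
IsBetaValuation G b =
  Injective _≡_ _≡_ b
  × (∀ v → b v ≤ #E G)
  × (edgeDiffs G b ↭ map suc (upTo (#E G)))

IsAlphaValuation : (G : Graph) → (Fin (V G) → ℕ) → Set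
IsAlphaValuation G b =
  IsBetaValuation G b
  × Σ ℕ (λ x → x ≤ #E G ×
      (∀ u v → Adj G u v → (b u ≤ x × x < b v) ⊎ (b v ≤ x × x < b u)))

IsNearAlphaValuation : (G : Graph) → (Fin (V G) → ℕ) → Set
IsNearAlphaValuation G b =
  IsBetaValuation G b
  × Σ (Fin (V G) → Bool) (λ small →
      ∀ v u → Adj G v u →
        (small v ≡ true → b v < b u) × (small v ≡ false → b u < b v))

children : (G : Graph) → Fin (V G) → List (Fin (V G))
children G v = map proj₂ (filter (λ e → proj₁ e F.≟ v) (E G))

#children : (G : Graph) → Fin (V G) → ℕ
#children G v = length (children G v)

isS : ℕ → ℕ → Bool
isS q s = not (s ≡ᵇ 0) ∧ any (λ x → (x * x) % suc q ≡ᵇ s) (upTo (suc q))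

isN : ℕ → ℕ → Bool
isN q s = not (s ≡ᵇ 0) ∧ not (any (λ x → (x * x) % suc q ≡ᵇ s) (upTo (suc q)))

-- Level 1: s ∈ N, or s ∈ S with s > p/2 (i.e. 2s > p,
-- p odd), child of 0.  Level 2: s ∈ S with s < p/2 (2s < p), child of
-- the vertex 2s (computed in GF(p)).
T : ℕ → Graph
T zero = mkGraph zero []
T (suc q) = mkGraph (suc q) (concatMap edgeAt (allFin (suc q)))
  where
    p = suc q
    level1 : ℕ → Bool
    level1 s = isN q s ∨ (isS q s ∧ (p <ᵇ (2 * s)))
    level2 : ℕ → Bool
    level2 s = isS q s ∧ ((2 * s) <ᵇ p)
    double : Fin p → Fin p
    double v = fromℕ< (m%n<n (2 * toℕ v) p)
    edgeAt : Fin p → List (Fin p × Fin p)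
    edgeAt v = if level1 (toℕ v) then [ (fzero , v) ]
               else (if level2 (toℕ v) then [ (double v , v) ] else [])

label : (p : ℕ) → Fin (V (T p)) → ℕ
label zero ()
label (suc q) v = toℕ v

{-# OPTIONS --safe #-}

-- Write p = 2h + 1. For p ≡ ±3 (mod 8), Gauss's lemma gives 2 ^ h ≡ −1, so by Euler's criterion doubling
-- sends nonzero squares to nonsquares; together with the h distinct squares 1², …, h² this shows that doubling
-- is a bijection from the h squares onto the h nonsquares. Hence a square s < p/2 hangs below 2s, which hangs
-- below 0: T is a rooted tree of depth two whose root children have at most one child each, and labelling each
-- vertex by itself gives edge differences 1, …, p ∸ 1 with the root and the grandchildren below their
-- neighbours. In an α-valuation the root and the grandchildren lie on one side of the threshold; then the two
-- largest or the two smallest differences would need two different leaf edges through one label, unless that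
-- side only uses the labels 0, 1, 2, too few for the root and three grandchildren (the squares 1, 4, 9, or
-- 1, 3, 4 when p is 11 or 13). For p ≡ 5 (mod 8), −1 is a square, so s ↦ p ∸ s exchanges the squares below
-- and above p/2, and there are exactly (p ∸ 1)/4 grandchildren.

module Submission where

open import Defs
open import Data.Nat using (ℕ; _≤_; _%_; _∸_; _*_; _/_)
open import Data.Nat.Primality using (Prime)
open import Data.Product using (_×_)
open import Data.Sum using (_⊎_)
open import Data.List using (length; filter)
open import Data.List.Membership.Propositional using (_∈_)
open import Relation.Nullary using (¬_)
open import Relation.Binary.PropositionalEquality using (_≡_; _≢_)
import Data.Nat as N

open import Data.Bool using (Bool; true; false; not; _∧_; _∨_; if_then_else_)
import Data.Bool as Bool
open import Data.Bool.ListAction using (any)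
open import Data.Bool.Properties using (T?)
open import Data.Empty using (⊥)
open import Data.Fin as Fin using (Fin; zero; suc; toℕ; fromℕ<)
import Data.Fin.Properties as Finₚ
open import Data.List using (List; []; _∷_; [_]; _++_; _∷ʳ_; map; concatMap; upTo; applyUpTo; tabulate)
open import Data.List.Base using (initLast; _∷ʳ′_)
open import Data.List.Membership.Propositional using (_∉_; lose)
open import Data.List.Membership.Propositional.Properties
  using (∈-∃++; ∈-++⁺ʳ; ∈-++⁻; ∈-filter⁺; ∈-filter⁻; ∈-map⁺; ∈-map⁻; ∈-upTo⁺; ∈-tabulate⁺; ∈-tabulate⁻)
open import Data.List.Properties
  using ( length-map; length-++; length-tabulate; length-filter; length-upTo
        ; map-++; map-∘; map-id; map-cong; map-tabulate; map-upTo)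
open import Data.List.Relation.Binary.Disjoint.Propositional using (Disjoint)
open import Data.List.Relation.Binary.Permutation.Propositional
  using (_↭_; ↭-refl; ↭-sym; ↭-trans; ↭-prep; ↭-reflexive; ↭⇒↭ₛ)
open import Data.List.Relation.Binary.Permutation.Propositional.Properties using (shift; ↭-length; ∈-resp-↭)
import Data.List.Relation.Binary.Permutation.Setoid.Properties as Permₛ
open import Data.List.Relation.Binary.Subset.Propositional using (_⊆_)
open import Data.List.Relation.Unary.All as All using (All; []; _∷_)
import Data.List.Relation.Unary.All.Properties as Allₚ
open import Data.List.Relation.Unary.AllPairs using ([]; _∷_)
import Data.List.Relation.Unary.AllPairs.Properties as AllPairsₚ
open import Data.List.Relation.Unary.Any using (here; there; satisfied)
open import Data.List.Relation.Unary.Any.Properties using (any⁺; any⁻)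
open import Data.List.Relation.Unary.Linked as Linked using (Linked; []; [-]; _∷_)
open import Data.List.Relation.Unary.Linked.Properties using (Linked⇒AllPairs)
open import Data.List.Relation.Unary.Unique.Propositional using (Unique)
import Data.List.Relation.Unary.Unique.Propositional.Properties as Uniqueₚ
open import Data.Nat
open import Data.Nat.DivMod
open import Data.Nat.Divisibility using (_∣_; divides; ∣⇒≤; m%n≡0⇒n∣m; n∣m⇒m%n≡0; ∣1⇒≡1; ∣m⇒∣m*n)
open import Data.Nat.ListAction using (product)
open import Data.Nat.ListAction.Properties using (product-↭; product-++)
open import Data.Nat.Primality using (euclidsLemma; prime⇒nonTrivial; prime⇒irreducible)
open import Data.Nat.Properties
open import Algebra.Properties.CommutativeSemigroup *-commutativeSemigroup using (interchange; x∙yz≈y∙xz)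
open import Algebra.Properties.CommutativeSemigroup +-commutativeSemigroup using (xy∙z≈xz∙y)
open import Data.Nat.Tactic.RingSolver using (solve-∀)
open import Data.Product using (_,_; proj₁; proj₂; Σ; ∃-syntax)
open import Data.Sum as Sum using (inj₁; inj₂)
open import Data.Unit using (⊤)
open import Function using (_∘_; id; flip)
open import Level using (0ℓ)
open import Relation.Binary using (Rel; Transitive; Irreflexive; IsEquivalence; Setoid; tri<; tri≈; tri>)
open import Relation.Binary.Construct.Closure.ReflexiveTransitive using (Star; ε; _◅_; _◅◅_; reverse)
open import Relation.Binary.PropositionalEquality hiding ([_])
import Relation.Binary.Reasoning.Setoid as SetoidReasoning
open import Relation.Nullary using (contradiction; yes; no; ¬?; does)
open import Relation.Unary using (Pred; Decidable)

^-distribʳ-* : ∀ a b n → (a * b) ^ n ≡ a ^ n * b ^ n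
^-distribʳ-* a b zero    = refl
^-distribʳ-* a b (suc n) = begin
  a * b * (a * b) ^ n       ≡⟨ cong (a * b *_) (^-distribʳ-* a b n) ⟩
  a * b * (a ^ n * b ^ n)   ≡⟨ interchange a b (a ^ n) (b ^ n) ⟩
  a * a ^ n * (b * b ^ n)   ∎
  where open ≡-Reasoning

[y∸x]*[y+x]≡y*y∸x*x : ∀ x y → (y ∸ x) * (y + x) ≡ y * y ∸ x * x
[y∸x]*[y+x]≡y*y∸x*x x y = begin
  (y ∸ x) * (y + x)                  ≡⟨ *-distribʳ-∸ (y + x) y x ⟩
  y * (y + x) ∸ x * (y + x)          ≡⟨ cong₂ _∸_ (*-distribˡ-+ y y x) (*-distribˡ-+ x y x) ⟩
  (y * y + y * x) ∸ (x * y + x * x)  ≡⟨ cong₂ _∸_ (+-comm (y * y) (y * x)) (cong (_+ x * x) (*-comm x y)) ⟩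
  (y * x + y * y) ∸ (y * x + x * x)  ≡⟨ [m+n]∸[m+o]≡n∸o (y * x) (y * y) (x * x) ⟩
  y * y ∸ x * x                      ∎
  where open ≡-Reasoning

n<2m⇒2[n∸m]<n : ∀ {m n} → m ≤ n → n < 2 * m → 2 * (n ∸ m) < n
n<2m⇒2[n∸m]<n {m} {n} m≤n n<2m = begin-strict
  2 * (n ∸ m)        ≡⟨ cong (n ∸ m +_) (+-identityʳ (n ∸ m)) ⟩
  n ∸ m + (n ∸ m)    <⟨ +-monoˡ-< (n ∸ m) n∸m<m ⟩
  m + (n ∸ m)        ≡⟨ m+[n∸m]≡n m≤n ⟩
  n                  ∎
  where
    open ≤-Reasoning
    n∸m<m : n ∸ m < m
    n∸m<m = +-cancelˡ-< m (n ∸ m) m (begin-strict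
      m + (n ∸ m)  ≡⟨ m+[n∸m]≡n m≤n ⟩
      n            <⟨ n<2m ⟩
      2 * m        ≡⟨ cong (m +_) (+-identityʳ m) ⟩
      m + m        ∎)

2[n∸m]<n⇒n<2m : ∀ {m n} → m ≤ n → 2 * (n ∸ m) < n → n < 2 * m
2[n∸m]<n⇒n<2m {m} {n} m≤n 2[n∸m]<n = begin-strict
  n              ≡⟨ m+[n∸m]≡n m≤n ⟨
  m + (n ∸ m)    <⟨ +-monoʳ-< m n∸m<m ⟩
  m + m          ≡⟨ cong (m +_) (+-identityʳ m) ⟨
  2 * m          ∎
  where
    open ≤-Reasoning
    n∸m<m : n ∸ m < m
    n∸m<m = +-cancelʳ-< (n ∸ m) (n ∸ m) m (begin-strict
      n ∸ m + (n ∸ m)  ≡⟨ cong (n ∸ m +_) (+-identityʳ (n ∸ m)) ⟨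
      2 * (n ∸ m)      <⟨ 2[n∸m]<n ⟩
      n                ≡⟨ m+[n∸m]≡n m≤n ⟨
      m + (n ∸ m)      ∎)

∣N∸a-N∸c∣≡∣a-c∣ : ∀ {N a c} → a ≤ N → c ≤ N → ∣ (N ∸ a) - (N ∸ c) ∣ ≡ ∣ a - c ∣
∣N∸a-N∸c∣≡∣a-c∣ {N} {a} {c} a≤N c≤N = begin
  ∣ (N ∸ a) - (N ∸ c) ∣                  ≡⟨ ∣m+n-m+o∣≡∣n-o∣ (a + c) (N ∸ a) (N ∸ c) ⟨
  ∣ a + c + (N ∸ a) - a + c + (N ∸ c) ∣  ≡⟨ cong₂ ∣_-_∣ N+c N+a ⟩
  ∣ N + c - N + a ∣                      ≡⟨ ∣m+n-m+o∣≡∣n-o∣ N c a ⟩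
  ∣ c - a ∣                              ≡⟨ ∣-∣-comm c a ⟩
  ∣ a - c ∣                              ∎
  where
    open ≡-Reasoning
    N+c : a + c + (N ∸ a) ≡ N + c
    N+c = trans (xy∙z≈xz∙y a c (N ∸ a)) (cong (_+ c) (m+[n∸m]≡n a≤N))
    N+a : a + c + (N ∸ c) ≡ N + a
    N+a = trans (+-assoc a c (N ∸ c)) (trans (cong (a +_) (m+[n∸m]≡n c≤N)) (+-comm a N))

m+n≤n⇒m≡0 : ∀ {m n} → m + n ≤ n → m ≡ 0
m+n≤n⇒m≡0 {m} {n} m+n≤n = n≤0⇒n≡0 (+-cancelʳ-≤ n m 0 m+n≤n)

≤1⇒≡0⊎≡1 : ∀ {m} → m ≤ 1 → m ≡ 0 ⊎ m ≡ 1
≤1⇒≡0⊎≡1 z≤n       = inj₁ refl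
≤1⇒≡0⊎≡1 (s≤s z≤n) = inj₂ refl

≤∧<+1⇒≡ : ∀ {m x} → m ≤ x → x < m + 1 → m ≡ x
≤∧<+1⇒≡ {m} {x} m≤x x<m+1 = ≤-antisym m≤x (s≤s⁻¹ (subst (x <_) (+-comm m 1) x<m+1))

≤∧<+2⇒≡⊎≡ : ∀ {m x} → m ≤ x → x < m + 2 → m ≡ x ⊎ suc m ≡ x
≤∧<+2⇒≡⊎≡ {m} {x} m≤x x<m+2 with m≤n⇒m<n∨m≡n m≤x
... | inj₂ m≡x = inj₁ m≡x
... | inj₁ m<x = inj₂ (≤∧<+1⇒≡ m<x (subst (x <_) (+-suc m 1) x<m+2))

suc-pred-of-positive : ∀ {m} → 1 ≤ m → suc (pred m) ≡ m
suc-pred-of-positive (s≤s _) = refl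

pred-positive : ∀ {m} → 2 ≤ m → 1 ≤ pred m
pred-positive (s≤s (s≤s _)) = s≤s z≤n

∣-∣≡⇒+≡ : ∀ {a c d} → a ≤ c → ∣ a - c ∣ ≡ d → a + d ≡ c
∣-∣≡⇒+≡ {a} {c} a≤c refl = trans (cong (a +_) (m≤n⇒∣m-n∣≡n∸m a≤c)) (m+[n∸m]≡n a≤c)

<⇒<ᵇ≡true : ∀ {m n} → m < n → (m <ᵇ n) ≡ true
<⇒<ᵇ≡true {m} {n} m<n with m <ᵇ n | <⇒<ᵇ m<n
... | true | _ = refl

≮⇒<ᵇ≡false : ∀ {m n} → ¬ m < n → (m <ᵇ n) ≡ false
≮⇒<ᵇ≡false {m} {n} m≮n with m <ᵇ n | <ᵇ⇒< m n
... | false | _      = refl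
... | true  | m<ᵇn⇒ = contradiction (m<ᵇn⇒ _) m≮n

if-true : ∀ {A : Set} {b} {x y : A} → b ≡ true → (if b then x else y) ≡ x
if-true refl = refl

if-false : ∀ {A : Set} {b} {x y : A} → b ≡ false → (if b then x else y) ≡ y
if-false refl = refl

<ᵇ≡true⇒< : ∀ {m n} → (m <ᵇ n) ≡ true → m < n
<ᵇ≡true⇒< {m} {n} eq = <ᵇ⇒< m n (subst Bool.T (sym eq) _)

prime-not-even : ∀ {p} → Prime p → 3 ≤ p → ∀ m → p ≢ 2 * m
prime-not-even isPrime 3≤p m p≡2m with prime⇒irreducible isPrime (divides m (trans p≡2m (*-comm 2 m)))
... | inj₂ 2≡p = <⇒≢ 3≤p 2≡p

module _ {A : Set} where

  private
    ∈-drop-mid : ∀ {x y : A} l r → y ∈ l ++ [ x ] ++ r → y ≢ x → y ∈ l ++ r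
    ∈-drop-mid l r y∈ y≢x with ∈-resp-↭ (shift _ l r) y∈
    ... | here y≡x    = contradiction y≡x y≢x
    ... | there y∈l++r = y∈l++r

    ⊆-drop-mid : ∀ {x : A} {xs} l r → All (x ≢_) xs → x ∷ xs ⊆ l ++ [ x ] ++ r → xs ⊆ l ++ r
    ⊆-drop-mid l r x∉xs ⊆ys y∈xs = ∈-drop-mid l r (⊆ys (there y∈xs)) (≢-sym (All.lookup x∉xs y∈xs))

    Unique-drop-mid : ∀ {x : A} l r → Unique (l ++ [ x ] ++ r) → Unique (l ++ r)
    Unique-drop-mid l r u with _ ∷ u′ ← Permₛ.Unique-resp-↭ (setoid A) (↭⇒↭ₛ (shift _ l r)) u = u′

  Unique-⊆⇒length≤ : ∀ {xs ys : List A} → Unique xs → xs ⊆ ys → length xs ≤ length ys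
  Unique-⊆⇒length≤ {[]}     _            _     = z≤n
  Unique-⊆⇒length≤ {x ∷ xs} (x∉xs ∷ !xs) xs⊆ys with l , r , refl ← ∈-∃++ (xs⊆ys (here refl)) = begin
    suc (length xs)          ≤⟨ s≤s (Unique-⊆⇒length≤ !xs (⊆-drop-mid l r x∉xs xs⊆ys)) ⟩
    suc (length (l ++ r))    ≡⟨ ↭-length (shift x l r) ⟨
    length (l ++ [ x ] ++ r) ∎
    where open ≤-Reasoning

  Unique-⊆⇒↭ : ∀ {xs ys : List A} → Unique xs → Unique ys → xs ⊆ ys → length ys ≤ length xs →
               xs ↭ ys
  Unique-⊆⇒↭ {[]}     {[]}    _            _   _     _ = ↭-refl
  Unique-⊆⇒↭ {x ∷ xs} {ys} (x∉xs ∷ !xs) !ys xs⊆ys ys≤xs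
    with l , r , refl ← ∈-∃++ (xs⊆ys (here refl)) =
    ↭-trans (↭-prep x (Unique-⊆⇒↭ !xs (Unique-drop-mid l r !ys) (⊆-drop-mid l r x∉xs xs⊆ys) lr≤xs))
            (↭-sym (shift x l r))
    where
      lr≤xs : length (l ++ r) ≤ length xs
      lr≤xs with s≤s le ← subst (_≤ suc (length xs)) (↭-length (shift x l r)) ys≤xs = le

  Unique-⊆-⊇⇒length≡ : ∀ {xs ys : List A} → Unique xs → Unique ys → xs ⊆ ys → ys ⊆ xs →
                       length xs ≡ length ys
  Unique-⊆-⊇⇒length≡ !xs !ys xs⊆ys ys⊆xs =
    ≤-antisym (Unique-⊆⇒length≤ !xs xs⊆ys) (Unique-⊆⇒length≤ !ys ys⊆xs)

  Unique-all-equal⇒length≤1 : ∀ {xs : List A} → Unique xs → (∀ {x y} → x ∈ xs → y ∈ xs → x ≡ y) →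
                              length xs ≡ 1 ⊎ length xs ≡ 0
  Unique-all-equal⇒length≤1 {[]}        _               _         = inj₂ refl
  Unique-all-equal⇒length≤1 {_ ∷ []}    _               _         = inj₁ refl
  Unique-all-equal⇒length≤1 {_ ∷ _ ∷ _} ((x≢y ∷ _) ∷ _) all-equal =
    contradiction (all-equal (here refl) (there (here refl))) x≢y

  ∈⇒length≢0 : ∀ {x : A} {xs} → x ∈ xs → length xs ≢ 0
  ∈⇒length≢0 (here _)  ()
  ∈⇒length≢0 (there _) ()

  length≡suc⇒∈ : ∀ {xs : List A} {n} → length xs ≡ suc n → ∃[ x ] x ∈ xs
  length≡suc⇒∈ {x ∷ _} _ = x , here refl

  length-filter+length-filter-¬ : ∀ {P : Pred A 0ℓ} (P? : Decidable P) xs →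
                                  length (filter P? xs) + length (filter (¬? ∘ P?) xs) ≡ length xs
  length-filter+length-filter-¬ P? []       = refl
  length-filter+length-filter-¬ P? (x ∷ xs) with P? x
  ... | yes _ = cong suc (length-filter+length-filter-¬ P? xs)
  ... | no  _ = trans (+-suc _ _) (cong suc (length-filter+length-filter-¬ P? xs))

module _ {A B : Set} where

  Unique-map⁺ : ∀ (f : A → B) {xs} → (∀ {x y} → x ∈ xs → y ∈ xs → f x ≡ f y → x ≡ y) →
                Unique xs → Unique (map f xs)
  Unique-map⁺ f {[]}     _   []           = []
  Unique-map⁺ f {x ∷ xs} inj (x∉xs ∷ !xs) =
    Allₚ.map⁺ (All.tabulate λ y∈xs fx≡fy → All.lookup x∉xs y∈xs (inj (here refl) (there y∈xs) fx≡fy))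
    ∷ Unique-map⁺ f (λ x∈ y∈ → inj (there x∈) (there y∈)) !xs

  filter-map : ∀ {P : Pred B 0ℓ} (P? : Decidable P) (f : A → B) xs →
               filter P? (map f xs) ≡ map f (filter (P? ∘ f) xs)
  filter-map P? f []       = refl
  filter-map P? f (x ∷ xs) with does (P? (f x))
  ... | true  = cong (f x ∷_) (filter-map P? f xs)
  ... | false = filter-map P? f xs

  concatMap-singleton : ∀ {f : A → List B} {g : A → B} {xs} → All (λ x → f x ≡ [ g x ]) xs →
                        concatMap f xs ≡ map g xs
  concatMap-singleton []              = refl
  concatMap-singleton (fx≡[gx] ∷ fxs) = cong₂ _++_ fx≡[gx] (concatMap-singleton fxs)

range : ℕ → ℕ → List ℕ
range s zero    = []
range s (suc n) = s ∷ range (suc s) n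

∈-range⁺ : ∀ {s x} n → s ≤ x → x < s + n → x ∈ range s n
∈-range⁺ {s} {x} zero    s≤x x<s+0 = contradiction (subst (x <_) (+-identityʳ s) x<s+0) (≤⇒≯ s≤x)
∈-range⁺ {s} {x} (suc n) s≤x x<s+n with m≤n⇒m<n∨m≡n s≤x
... | inj₂ refl = here refl
... | inj₁ s<x  = there (∈-range⁺ n s<x (subst (x <_) (+-suc s n) x<s+n))

∈-range⁻ : ∀ {s x} n → x ∈ range s n → s ≤ x × x < s + n
∈-range⁻ {s} (suc n) (here refl) = ≤-refl , subst (s <_) (sym (+-suc s n)) (s<s (m≤m+n s n))
∈-range⁻ {s} {x} (suc n) (there x∈) with s<x , x<s+n ← ∈-range⁻ n x∈ =
  <⇒≤ s<x , subst (x <_) (sym (+-suc s n)) x<s+n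

range-unique : ∀ s n → Unique (range s n)
range-unique s zero    = []
range-unique s (suc n) = All.tabulate (λ x∈ → <⇒≢ (proj₁ (∈-range⁻ n x∈))) ∷ range-unique (suc s) n

length-range : ∀ s n → length (range s n) ≡ n
length-range s zero    = refl
length-range s (suc n) = cong suc (length-range (suc s) n)

range-++ : ∀ s m n → range s (m + n) ≡ range s m ++ range (s + m) n
range-++ s zero    n = cong (λ t → range t n) (sym (+-identityʳ s))
range-++ s (suc m) n = cong (s ∷_) (begin
  range (suc s) (m + n)                   ≡⟨ range-++ (suc s) m n ⟩
  range (suc s) m ++ range (suc s + m) n  ≡⟨ cong (λ t → range (suc s) m ++ range t n) (+-suc s m) ⟨
  range (suc s) m ++ range (s + suc m) n  ∎)
  where open ≡-Reasoning

tabulate-toℕ : ∀ {A : Set} n (f : ℕ → A) → tabulate {n = n} (λ i → f (toℕ i)) ≡ applyUpTo f n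
tabulate-toℕ zero    f = refl
tabulate-toℕ (suc n) f = cong (f 0 ∷_) (tabulate-toℕ n (λ k → f (suc k)))

product-map-*ˡ : ∀ c xs → product (map (c *_) xs) ≡ c ^ length xs * product xs
product-map-*ˡ c []       = refl
product-map-*ˡ c (x ∷ xs) = begin
  c * x * product (map (c *_) xs)       ≡⟨ cong (c * x *_) (product-map-*ˡ c xs) ⟩
  c * x * (c ^ length xs * product xs)  ≡⟨ interchange c x (c ^ length xs) (product xs) ⟩
  c * c ^ length xs * (x * product xs)  ∎
  where open ≡-Reasoning

-- Arithmetic modulo p

-- Residues modulo p = suc q are represented by natural numbers, and q stands for −1.
module Congruence (q : ℕ) where

  p : ℕ
  p = suc q

  -- A record rather than a bare equation, so that a and b can be inferred from a proof of a ≈ b.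
  infix 4 _≈_
  record _≈_ (a b : ℕ) : Set where
    constructor mod≡
    field %≡% : a % p ≡ b % p
  open _≈_ public

  ≈-isEquivalence : IsEquivalence _≈_
  ≈-isEquivalence = record
    { refl  = mod≡ refl
    ; sym   = λ (mod≡ e) → mod≡ (sym e)
    ; trans = λ (mod≡ e) (mod≡ f) → mod≡ (trans e f)
    }

  ≈-setoid : Setoid 0ℓ 0ℓ
  ≈-setoid = record { isEquivalence = ≈-isEquivalence }

  open IsEquivalence ≈-isEquivalence public
    using () renaming (refl to ≈-refl; sym to ≈-sym; trans to ≈-trans; reflexive to ≈-reflexive)

  module ≈-Reasoning = SetoidReasoning ≈-setoid

  %-≈ : ∀ a → a % p ≈ a
  %-≈ a = mod≡ (m%n%n≡m%n a p)

  +-*p-≈ : ∀ a k → a + k * p ≈ a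
  +-*p-≈ a k = mod≡ ([m+kn]%n≡m%n a k p)


  *-cong : ∀ {a b c d} → a ≈ b → c ≈ d → a * c ≈ b * d
  *-cong {a} {b} {c} {d} (mod≡ e) (mod≡ f) = mod≡ (begin
    (a * c) % p             ≡⟨ %-distribˡ-* a c p ⟩
    (a % p * (c % p)) % p   ≡⟨ cong₂ (λ x y → (x * y) % p) e f ⟩
    (b % p * (d % p)) % p   ≡⟨ %-distribˡ-* b d p ⟨
    (b * d) % p             ∎)
    where open ≡-Reasoning

  ^-congˡ : ∀ {a b} n → a ≈ b → a ^ n ≈ b ^ n
  ^-congˡ zero    _   = ≈-refl
  ^-congˡ (suc n) a≈b = *-cong a≈b (^-congˡ n a≈b)

  <⇒≈⇒≡ : ∀ {a b} → a < p → b < p → a ≈ b → a ≡ b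
  <⇒≈⇒≡ {a} {b} a<p b<p (mod≡ e) = begin
    a       ≡⟨ m<n⇒m%n≡m a<p ⟨
    a % p   ≡⟨ e ⟩
    b % p   ≡⟨ m<n⇒m%n≡m b<p ⟩
    b       ∎
    where open ≡-Reasoning

  ≈0⇒∣ : ∀ {a} → a ≈ 0 → p ∣ a
  ≈0⇒∣ {a} (mod≡ e) = m%n≡0⇒n∣m a p e

  ∣⇒≈0 : ∀ {a} → p ∣ a → a ≈ 0
  ∣⇒≈0 {a} p∣a = mod≡ (n∣m⇒m%n≡0 a p p∣a)

  ≈⇒∣∸ : ∀ {a b} → a ≈ b → p ∣ b ∸ a
  ≈⇒∣∸ {a} {b} (mod≡ e) = divides (b / p ∸ a / p) (begin
    b ∸ a                                   ≡⟨ cong₂ _∸_ (m≡m%n+[m/n]*n b p) (m≡m%n+[m/n]*n a p) ⟩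
    (b % p + b / p * p) ∸ (a % p + a / p * p) ≡⟨ cong (λ r → (b % p + b / p * p) ∸ (r + a / p * p)) e ⟩
    (b % p + b / p * p) ∸ (b % p + a / p * p) ≡⟨ [m+n]∸[m+o]≡n∸o (b % p) _ _ ⟩
    b / p * p ∸ a / p * p                   ≡⟨ *-distribʳ-∸ p (b / p) (a / p) ⟨
    (b / p ∸ a / p) * p                     ∎)
    where open ≡-Reasoning

  ∣-<⇒≡0 : ∀ {d} → p ∣ d → d < p → d ≡ 0
  ∣-<⇒≡0 {zero}  _   _   = refl
  ∣-<⇒≡0 {suc d} p∣d d<p = contradiction (∣⇒≤ p∣d) (<⇒≱ d<p)

  0<∧<⇒∤ : ∀ {a} → 0 < a → a < p → ¬ p ∣ a
  0<∧<⇒∤ 0<a a<p p∣a = <⇒≢ 0<a (sym (∣-<⇒≡0 p∣a a<p))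

module PrimeModulus (q : ℕ) (isPrime : Prime (suc q)) where

  open Congruence q public

  ∤-* : ∀ {a b} → ¬ p ∣ a → ¬ p ∣ b → ¬ p ∣ a * b
  ∤-* {a} {b} p∤a p∤b p∣ab = Sum.[ p∤a , p∤b ] (euclidsLemma a b isPrime p∣ab)

  ∤-product : ∀ {xs} → All (λ x → ¬ p ∣ x) xs → ¬ p ∣ product xs
  ∤-product []           p∣1 with () ← subst Data.Nat.NonTrivial (∣1⇒≡1 p∣1) (prime⇒nonTrivial isPrime)
  ∤-product (p∤x ∷ p∤xs) = ∤-* p∤x (∤-product p∤xs)

  ∣∸⇒≈ : ∀ {a b} → a ≤ b → p ∣ b ∸ a → a ≈ b
  ∣∸⇒≈ {a} {b} a≤b (divides k b∸a≡kp) = ≈-sym (begin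
    b            ≡⟨ m+[n∸m]≡n a≤b ⟨
    a + (b ∸ a)  ≡⟨ cong (a +_) b∸a≡kp ⟩
    a + k * p    ≈⟨ +-*p-≈ a k ⟩
    a            ∎)
    where open ≈-Reasoning

  ∣-*-∤ʳ : ∀ {a c} → ¬ p ∣ c → p ∣ a * c → p ∣ a
  ∣-*-∤ʳ {a} {c} p∤c p∣ac = Sum.[ id , flip contradiction p∤c ] (euclidsLemma a c isPrime p∣ac)

  private
    *-cancelʳ-≈-≤ : ∀ {a b c} → ¬ p ∣ c → a ≤ b → a * c ≈ b * c → a ≈ b
    *-cancelʳ-≈-≤ {a} {b} {c} p∤c a≤b ac≈bc =
      ∣∸⇒≈ a≤b (∣-*-∤ʳ p∤c (subst (p ∣_) (sym (*-distribʳ-∸ c b a)) (≈⇒∣∸ ac≈bc)))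

  *-cancelʳ-≈ : ∀ {a b c} → ¬ p ∣ c → a * c ≈ b * c → a ≈ b
  *-cancelʳ-≈ {a} {b} p∤c ac≈bc with ≤-total a b
  ... | inj₁ a≤b = *-cancelʳ-≈-≤ p∤c a≤b ac≈bc
  ... | inj₂ b≤a = ≈-sym (*-cancelʳ-≈-≤ p∤c b≤a (≈-sym ac≈bc))

  units : List ℕ
  units = range 1 q

  ∈-units⁺ : ∀ {x} → x ≢ 0 → x < p → x ∈ units
  ∈-units⁺ x≢0 x<p = ∈-range⁺ q (n≢0⇒n>0 x≢0) x<p

  ∈-units⇒∤ : ∀ {x} → x ∈ units → ¬ p ∣ x
  ∈-units⇒∤ x∈ = let 0<x , x<p = ∈-range⁻ q x∈ in 0<∧<⇒∤ 0<x x<p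

  ∈-units⇒< : ∀ {x} → x ∈ units → x < p
  ∈-units⇒< x∈ = proj₂ (∈-range⁻ q x∈)

  ∤-product-units : ¬ p ∣ product units
  ∤-product-units = ∤-product (All.tabulate ∈-units⇒∤)

  product-cong : ∀ {f g : ℕ → ℕ} xs → (∀ {x} → x ∈ xs → f x ≈ g x) →
                 product (map f xs) ≈ product (map g xs)
  product-cong []       _     = ≈-refl
  product-cong (x ∷ xs) f≈g = *-cong (f≈g (here refl)) (product-cong xs (f≈g ∘ there))

  fermat : ∀ {a} → ¬ p ∣ a → a ^ q ≈ 1
  fermat {a} p∤a = *-cancelʳ-≈ ∤-product-units (begin
    a ^ q * product units              ≡⟨ cong (λ n → a ^ n * product units) (length-range 1 q) ⟨
    a ^ length units * product units   ≡⟨ product-map-*ˡ a units ⟨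
    product (map (a *_) units)         ≈⟨ product-cong units (λ _ → ≈-sym (%-≈ _)) ⟩
    product (map multiply units)       ≡⟨ product-↭ permutes ⟩
    product units                      ≡⟨ *-identityˡ _ ⟨
    1 * product units                  ∎)
    where
      open ≈-Reasoning
      multiply : ℕ → ℕ
      multiply i = a * i % p
      injective : ∀ {i j} → i ∈ units → j ∈ units → multiply i ≡ multiply j → i ≡ j
      injective {i} {j} i∈ j∈ ai≡aj = <⇒≈⇒≡ (∈-units⇒< i∈) (∈-units⇒< j∈) (*-cancelʳ-≈ p∤a (begin
        i * a   ≡⟨ *-comm i a ⟩
        a * i   ≈⟨ mod≡ ai≡aj ⟩
        a * j   ≡⟨ *-comm a j ⟩
        j * a   ∎))
      into : ∀ {x} → x ∈ map multiply units → x ∈ units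
      into x∈ with i , i∈ , refl ← ∈-map⁻ multiply x∈ =
        ∈-units⁺ (λ ai≡0 → ∤-* p∤a (∈-units⇒∤ i∈) (≈0⇒∣ (mod≡ ai≡0))) (m%n<n (a * i) p)
      permutes : map multiply units ↭ units
      permutes = Unique-⊆⇒↭ (Unique-map⁺ multiply injective (range-unique 1 q)) (range-unique 1 q) into
                   (≤-reflexive (sym (length-map multiply units)))

  q*[p∸x]≈x : ∀ {x} → x ≤ q → q * (p ∸ x) ≈ x
  q*[p∸x]≈x {x} x≤q = begin
    q * (p ∸ x)              ≡⟨ cong₂ _*_ (m∸n+n≡m x≤q) (sym (+-∸-assoc 1 x≤q)) ⟨
    (u + x) * (1 + u)        ≡⟨ expand u x ⟩
    x + u * (1 + (u + x))    ≡⟨ cong (λ n → x + u * suc n) (m∸n+n≡m x≤q) ⟩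
    x + u * p                ≈⟨ +-*p-≈ x u ⟩
    x                        ∎
    where
      open ≈-Reasoning
      u : ℕ
      u = q ∸ x
      expand : ∀ u x → (u + x) * (1 + u) ≡ x + u * (1 + (u + x))
      expand = solve-∀

  q*q≈1 : 1 ≤ q → q * q ≈ 1
  q*q≈1 = q*[p∸x]≈x

  q^[1+2j]≈q : 1 ≤ q → ∀ j → q ^ suc (2 * j) ≈ q
  q^[1+2j]≈q 1≤q j = begin
    q * q ^ (2 * j)   ≡⟨ cong (q *_) (^-*-assoc q 2 j) ⟨
    q * (q ^ 2) ^ j   ≡⟨ cong (λ x → q * (q * x) ^ j) (*-identityʳ q) ⟩
    q * (q * q) ^ j   ≈⟨ *-cong (≈-refl {q}) (^-congˡ j (q*q≈1 1≤q)) ⟩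
    q * 1 ^ j         ≡⟨ cong (q *_) (^-zeroˡ j) ⟩
    q * 1             ≡⟨ *-identityʳ q ⟩
    q                 ∎
    where open ≈-Reasoning

  module _ {h} (q≡2h : q ≡ 2 * h) where

    firstHalf : List ℕ
    firstHalf = range 1 h

    h<p : h < p
    h<p = s≤s (subst (h ≤_) (sym q≡2h) (m≤m+n h (h + 0)))

    ∤-product-firstHalf : ¬ p ∣ product firstHalf
    ∤-product-firstHalf = ∤-product (All.tabulate λ j∈ →
      let 0<j , j<1+h = ∈-range⁻ h j∈ in 0<∧<⇒∤ 0<j (≤-trans j<1+h h<p))

    -- Gauss's lemma for 2: j ↦ 2 j on 1 … m together with j ↦ p ∸ 2 j ≈ −2 j on m + 1 … h permutes 1 … h,
    -- so comparing products gives 2 ^ h h! ≈ (−1) ^ μ h!.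
    module GaussLemmaForTwo (m μ : ℕ) (h≡m+μ : h ≡ m + μ) (2m≤h : 2 * m ≤ h) (h≤1+2m : h ≤ suc (2 * m))
      where

      lower upper : List ℕ
      lower = range 1 m
      upper = range (1 + m) μ

      reflect : ℕ → ℕ
      reflect j = p ∸ 2 * j

      1+m≤j : ∀ {j} → j ∈ upper → suc m ≤ j
      1+m≤j j∈ = proj₁ (∈-range⁻ μ j∈)
      j≤h : ∀ {j} → j ∈ upper → j ≤ h
      j≤h {j} j∈ = s≤s⁻¹ (subst (j <_) (sym (cong suc h≡m+μ)) (proj₂ (∈-range⁻ μ j∈)))
      2j≤q : ∀ {j} → j ∈ upper → 2 * j ≤ q
      2j≤q {j} j∈ = subst (2 * j ≤_) (sym q≡2h) (*-monoʳ-≤ 2 (j≤h j∈))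
      2j≤p : ∀ {j} → j ∈ upper → 2 * j ≤ p
      2j≤p j∈ = m≤n⇒m≤1+n (2j≤q j∈)
      p≤2j+h : ∀ {j} → j ∈ upper → p ≤ 2 * j + h
      p≤2j+h {j} j∈ = begin
        p                      ≡⟨ cong suc q≡2h ⟩
        suc (h + (h + 0))      ≤⟨ s≤s (+-monoʳ-≤ h (subst (_≤ suc (2 * m)) (sym (+-identityʳ h)) h≤1+2m)) ⟩
        suc (h + suc (2 * m))  ≡⟨ rearrange h m ⟩
        2 * suc m + h          ≤⟨ +-monoˡ-≤ h (*-monoʳ-≤ 2 (1+m≤j j∈)) ⟩
        2 * j + h              ∎
        where
          open ≤-Reasoning
          rearrange : ∀ h m → suc (h + suc (2 * m)) ≡ 2 * suc m + h
          rearrange = solve-∀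
      into : ∀ {x} → x ∈ map (2 *_) lower ++ map reflect upper → x ∈ firstHalf
      into x∈ with ∈-++⁻ (map (2 *_) lower) x∈
      ... | inj₁ x∈lower with i , i∈ , refl ← ∈-map⁻ (2 *_) x∈lower =
        let 1≤i , i<1+m = ∈-range⁻ m i∈ in
        ∈-range⁺ h (≤-trans 1≤i (m≤m+n i (i + 0))) (s≤s (≤-trans (*-monoʳ-≤ 2 (s≤s⁻¹ i<1+m)) 2m≤h))
      ... | inj₂ x∈upper with j , j∈ , refl ← ∈-map⁻ reflect x∈upper =
        ∈-range⁺ h (m<n⇒0<n∸m (s≤s (2j≤q j∈))) (s≤s (m≤n+o⇒m∸n≤o p (2 * j) (p≤2j+h j∈)))
      disjoint : Disjoint (map (2 *_) lower) (map reflect upper)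
      disjoint (x∈lower , x∈upper)
        with i , _ , refl ← ∈-map⁻ (2 *_) x∈lower | j , j∈ , 2i≡p∸2j ← ∈-map⁻ reflect x∈upper =
        even≢odd (i + j) h (begin
          2 * (i + j)        ≡⟨ *-distribˡ-+ 2 i j ⟩
          2 * i + 2 * j      ≡⟨ cong (_+ 2 * j) 2i≡p∸2j ⟩
          p ∸ 2 * j + 2 * j  ≡⟨ m∸n+n≡m (2j≤p j∈) ⟩
          p                  ≡⟨ cong suc q≡2h ⟩
          suc (2 * h)        ∎)
        where open ≡-Reasoning
      unique : Unique (map (2 *_) lower ++ map reflect upper)
      unique = Uniqueₚ.++⁺
        (Unique-map⁺ (2 *_) (λ _ _ → *-cancelˡ-≡ _ _ 2) (range-unique 1 m))
        (Unique-map⁺ reflect (λ i∈ j∈ → *-cancelˡ-≡ _ _ 2 ∘ ∸-cancelˡ-≡ (2j≤p i∈) (2j≤p j∈))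
                     (range-unique (1 + m) μ))
        disjoint
      permutes : map (2 *_) lower ++ map reflect upper ↭ firstHalf
      permutes = Unique-⊆⇒↭ unique (range-unique 1 h) into (≤-reflexive (begin
        length firstHalf                                        ≡⟨ length-range 1 h ⟩
        h                                                       ≡⟨ h≡m+μ ⟩
        m + μ                                                   ≡⟨ cong₂ _+_ (length-range 1 m) (length-range _ μ) ⟨
        length lower + length upper                             ≡⟨ cong₂ _+_ (length-map _ lower) (length-map _ upper) ⟨
        length (map (2 *_) lower) + length (map reflect upper)  ≡⟨ length-++ (map (2 *_) lower) ⟨
        length (map (2 *_) lower ++ map reflect upper)          ∎))
        where open ≡-Reasoning

      doubling-firstHalf : product (map (2 *_) firstHalf) ≈ q ^ μ * product (map (2 *_) lower ++ map reflect upper)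
      doubling-firstHalf = begin
        product (map (2 *_) firstHalf)                  ≡⟨ cong (product ∘ map (2 *_)) firstHalf≡lower++upper ⟩
        product (map (2 *_) (lower ++ upper))           ≡⟨ cong product (map-++ (2 *_) lower upper) ⟩
        product (map (2 *_) lower ++ map (2 *_) upper)  ≡⟨ product-++ (map (2 *_) lower) _ ⟩
        L * product (map (2 *_) upper)
          ≈⟨ *-cong (≈-refl {L}) (product-cong upper λ j∈ → ≈-sym (q*[p∸x]≈x (2j≤q j∈))) ⟩
        L * product (map (λ j → q * reflect j) upper)
          ≡⟨ cong (L *_) (trans (cong product (map-∘ upper)) (product-map-*ˡ q (map reflect upper))) ⟩
        L * (q ^ length (map reflect upper) * R)
          ≡⟨ cong (λ n → L * (q ^ n * R)) (trans (length-map reflect upper) (length-range _ μ)) ⟩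
        L * (q ^ μ * R)                                 ≡⟨ x∙yz≈y∙xz L (q ^ μ) R ⟩
        q ^ μ * (L * R)                                 ≡⟨ cong (q ^ μ *_) (product-++ (map (2 *_) lower) _) ⟨
        q ^ μ * product (map (2 *_) lower ++ map reflect upper) ∎
        where
          open ≈-Reasoning
          L R : ℕ
          L = product (map (2 *_) lower)
          R = product (map reflect upper)
          firstHalf≡lower++upper : firstHalf ≡ lower ++ upper
          firstHalf≡lower++upper = trans (cong (range 1) h≡m+μ) (range-++ 1 m μ)

      2^h≈q^μ : 2 ^ h ≈ q ^ μ
      2^h≈q^μ = *-cancelʳ-≈ ∤-product-firstHalf (begin
        2 ^ h * product firstHalf
          ≡⟨ cong (λ n → 2 ^ n * product firstHalf) (length-range 1 h) ⟨
        2 ^ length firstHalf * product firstHalf                 ≡⟨ product-map-*ˡ 2 firstHalf ⟨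
        product (map (2 *_) firstHalf)                           ≈⟨ doubling-firstHalf ⟩
        q ^ μ * product (map (2 *_) lower ++ map reflect upper)  ≡⟨ cong (q ^ μ *_) (product-↭ permutes) ⟩
        q ^ μ * product firstHalf                                ∎)
        where open ≈-Reasoning

    gauss-two : ∀ m j → h ≡ m + suc (2 * j) → 2 * m ≤ h → h ≤ suc (2 * m) → 2 ^ h ≈ q
    gauss-two m j h≡m+[1+2j] 2m≤h h≤1+2m =
      ≈-trans (GaussLemmaForTwo.2^h≈q^μ m (suc (2 * j)) h≡m+[1+2j] 2m≤h h≤1+2m) (q^[1+2j]≈q 1≤q j)
      where
        1≤h : 1 ≤ h
        1≤h = subst (1 ≤_) (sym h≡m+[1+2j]) (≤-trans (s≤s z≤n) (m≤n+m (suc (2 * j)) m))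
        1≤q : 1 ≤ q
        1≤q = subst (1 ≤_) (sym q≡2h) (≤-trans 1≤h (m≤m+n h (h + 0)))

-- Quadratic residues

module QuadraticResidues (q : ℕ) (isPrime : Prime (suc q)) {h} (q≡2h : q ≡ 2 * h) where

  open PrimeModulus q isPrime public

  Square : ℕ → Set
  Square s = ∃[ x ] x * x % p ≡ s

  Residue NonResidue : ℕ → Set
  Residue    s = s ≢ 0 × Square s
  NonResidue s = s ≢ 0 × ¬ Square s

  private
    hasRoot⇒Square : ∀ {s} → Bool.T (any (λ x → x * x % p ≡ᵇ s) (upTo p)) → Square s
    hasRoot⇒Square {s} t with x , xx≡ᵇs ← satisfied (any⁻ _ (upTo p) t) = x , ≡ᵇ⇒≡ _ s xx≡ᵇs

    Square⇒hasRoot : ∀ {s} → Square s → Bool.T (any (λ x → x * x % p ≡ᵇ s) (upTo p))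
    Square⇒hasRoot {s} (x , xx≡s) =
      any⁺ _ (lose (∈-upTo⁺ (m%n<n x p)) (≡⇒≡ᵇ _ s (trans (%≡% (*-cong (%-≈ x) (%-≈ x))) xx≡s)))

    T-not⇒¬T : ∀ {b} → Bool.T (not b) → ¬ Bool.T b
    T-not⇒¬T {false} _ ()

    ¬T⇒T-not : ∀ {b} → ¬ Bool.T b → Bool.T (not b)
    ¬T⇒T-not {false} _  = _
    ¬T⇒T-not {true}  ¬t = ¬t _

  isS⇒Residue : ∀ {s} → Bool.T (isS q s) → Residue s
  isS⇒Residue {suc s} t = (λ ()) , hasRoot⇒Square t

  Residue⇒isS : ∀ {s} → Residue s → Bool.T (isS q s)
  Residue⇒isS {zero}  (0≢0 , _)  = contradiction refl 0≢0
  Residue⇒isS {suc s} (_ , □s) = Square⇒hasRoot □s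

  isN⇒NonResidue : ∀ {s} → Bool.T (isN q s) → NonResidue s
  isN⇒NonResidue {suc s} t = (λ ()) , T-not⇒¬T t ∘ Square⇒hasRoot

  NonResidue⇒isN : ∀ {s} → NonResidue s → Bool.T (isN q s)
  NonResidue⇒isN {zero}  (0≢0 , _)  = contradiction refl 0≢0
  NonResidue⇒isN {suc s} (_ , ¬□s) = ¬T⇒T-not (¬□s ∘ hasRoot⇒Square)

  Square⇒< : ∀ {s} → Square s → s < p
  Square⇒< (x , refl) = m%n<n (x * x) p

  Residue⇒∤ : ∀ {s} → Residue s → ¬ p ∣ s
  Residue⇒∤ (s≢0 , □s) = 0<∧<⇒∤ (n≢0⇒n>0 s≢0) (Square⇒< □s)

  ∤⇒Residue : ∀ {x} → ¬ p ∣ x → Residue (x * x % p)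
  ∤⇒Residue {x} p∤x = (λ xx≡0 → ∤-* p∤x p∤x (≈0⇒∣ (mod≡ xx≡0))) , x , refl

  euler-residue : ∀ {s} → Residue s → s ^ h ≈ 1
  euler-residue (s≢0 , x , refl) = begin
    (x * x % p) ^ h  ≈⟨ ^-congˡ h (%-≈ (x * x)) ⟩
    (x * x) ^ h      ≡⟨ ^-distribʳ-* x x h ⟩
    x ^ h * x ^ h    ≡⟨ ^-distribˡ-+-* x h h ⟨
    x ^ (h + h)      ≡⟨ cong (x ^_) (trans (cong (h +_) (sym (+-identityʳ h))) (sym q≡2h)) ⟩
    x ^ q            ≈⟨ fermat (λ p∣x → s≢0 (%≡% (∣⇒≈0 (∣m⇒∣m*n x p∣x)))) ⟩
    1                ∎
    where open ≈-Reasoning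

  2≤q : 2 ≤ q
  2≤q = subst (2 ≤_) (sym q≡2h) (*-monoʳ-≤ 2 (n≢0⇒n>0 h≢0))
    where
      h≢0 : h ≢ 0
      h≢0 h≡0 = nonTrivial⇒≢1 {{prime⇒nonTrivial isPrime}} (cong suc (trans q≡2h (cong (2 *_) h≡0)))

  1≉q : ¬ 1 ≈ q
  1≉q 1≈q = even≢odd h 0 (trans (sym q≡2h) (sym (<⇒≈⇒≡ (s≤s (≤-trans (s≤s z≤n) 2≤q)) ≤-refl 1≈q)))

  private
    ∣y*y∸x*x⇒y≤x : ∀ {x y} → 0 < y + x → y + x < p → p ∣ y * y ∸ x * x → y ≤ x
    ∣y*y∸x*x⇒y≤x {x} {y} 0<y+x y+x<p p∣ = m∸n≡0⇒m≤n (∣-<⇒≡0 p∣y∸x y∸x<p)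
      where
        p∣y∸x : p ∣ y ∸ x
        p∣y∸x = ∣-*-∤ʳ (0<∧<⇒∤ 0<y+x y+x<p) (subst (p ∣_) (sym ([y∸x]*[y+x]≡y*y∸x*x x y)) p∣)
        y∸x<p : y ∸ x < p
        y∸x<p = ≤-<-trans (m∸n≤m y x) (≤-<-trans (m≤m+n y x) y+x<p)

  square-injective : ∀ {x y} → 0 < x → x + y < p → x * x ≈ y * y → x ≡ y
  square-injective {x} {y} 0<x x+y<p xx≈yy with ≤-total x y
  ... | inj₁ x≤y = ≤-antisym x≤y (∣y*y∸x*x⇒y≤x (subst (0 <_) (+-comm x y) (≤-trans 0<x (m≤m+n x y)))
                                               (subst (_< p) (+-comm x y) x+y<p) (≈⇒∣∸ xx≈yy))
  ... | inj₂ y≤x = ≤-antisym (∣y*y∸x*x⇒y≤x (≤-trans 0<x (m≤m+n x y)) x+y<p (≈⇒∣∸ (≈-sym xx≈yy))) y≤x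

  residues nonresidues : List ℕ
  residues    = filter (T? ∘ isS q) units
  nonresidues = filter (T? ∘ isN q) units

  ∈-residues⁺ : ∀ {s} → Residue s → s ∈ residues
  ∈-residues⁺ res@(s≢0 , □s) = ∈-filter⁺ (T? ∘ isS q) (∈-units⁺ s≢0 (Square⇒< □s)) (Residue⇒isS res)

  ∈-residues⁻ : ∀ {s} → s ∈ residues → Residue s
  ∈-residues⁻ = isS⇒Residue ∘ proj₂ ∘ ∈-filter⁻ (T? ∘ isS q) {xs = units}

  ∈-nonresidues⁺ : ∀ {s} → NonResidue s → s < p → s ∈ nonresidues
  ∈-nonresidues⁺ nres@(s≢0 , _) s<p = ∈-filter⁺ (T? ∘ isN q) (∈-units⁺ s≢0 s<p) (NonResidue⇒isN nres)

  ∈-nonresidues⁻ : ∀ {s} → s ∈ nonresidues → NonResidue s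
  ∈-nonresidues⁻ = isN⇒NonResidue ∘ proj₂ ∘ ∈-filter⁻ (T? ∘ isN q) {xs = units}

  residues-unique : Unique residues
  residues-unique = Uniqueₚ.filter⁺ (T? ∘ isS q) (range-unique 1 q)

  nonresidues-unique : Unique nonresidues
  nonresidues-unique = Uniqueₚ.filter⁺ (T? ∘ isN q) (range-unique 1 q)

  h≤#residues : h ≤ length residues
  h≤#residues = begin
    h                                  ≡⟨ length-range 1 h ⟨
    length (firstHalf {h} q≡2h)            ≡⟨ length-map square (firstHalf {h} q≡2h) ⟨
    length (map square (firstHalf {h} q≡2h))
      ≤⟨ Unique-⊆⇒length≤ (Unique-map⁺ square injective (range-unique 1 h)) into ⟩
    length residues                    ∎
    where
      open ≤-Reasoning
      square : ℕ → ℕ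
      square x = x * x % p
      bounds : ∀ {x} → x ∈ firstHalf {h} q≡2h → 0 < x × x ≤ h
      bounds x∈ = let 0<x , x<1+h = ∈-range⁻ h x∈ in 0<x , s≤s⁻¹ x<1+h
      x+y<p : ∀ {x y} → x ≤ h → y ≤ h → x + y < p
      x+y<p x≤h y≤h = s≤s (subst (_ ≤_) (trans (cong (h +_) (sym (+-identityʳ h))) (sym q≡2h))
                                         (+-mono-≤ x≤h y≤h))
      injective : ∀ {x y} → x ∈ firstHalf {h} q≡2h → y ∈ firstHalf {h} q≡2h → square x ≡ square y → x ≡ y
      injective x∈ y∈ xx≡yy =
        square-injective (proj₁ (bounds x∈)) (x+y<p (proj₂ (bounds x∈)) (proj₂ (bounds y∈))) (mod≡ xx≡yy)
      into : ∀ {s} → s ∈ map square (firstHalf {h} q≡2h) → s ∈ residues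
      into s∈ with x , x∈ , refl ← ∈-map⁻ square s∈ =
        ∈-residues⁺ (∤⇒Residue (0<∧<⇒∤ (proj₁ (bounds x∈)) (≤-<-trans (proj₂ (bounds x∈)) (h<p {h} q≡2h))))

  residues-nonresidues-disjoint : Disjoint residues nonresidues
  residues-nonresidues-disjoint (s∈R , s∈N) = proj₂ (∈-nonresidues⁻ s∈N) (proj₂ (∈-residues⁻ s∈R))

  #residues+#nonresidues≤q : length residues + length nonresidues ≤ q
  #residues+#nonresidues≤q = begin
    length residues + length nonresidues  ≡⟨ length-++ residues ⟨
    length (residues ++ nonresidues)      ≤⟨ Unique-⊆⇒length≤ unique into ⟩
    length units                          ≡⟨ length-range 1 q ⟩
    q                                     ∎
    where
      open ≤-Reasoning
      unique : Unique (residues ++ nonresidues)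
      unique = Uniqueₚ.++⁺ residues-unique nonresidues-unique residues-nonresidues-disjoint
      into : ∀ {s} → s ∈ residues ++ nonresidues → s ∈ units
      into s∈ with ∈-++⁻ residues s∈
      ... | inj₁ s∈R = proj₁ (∈-filter⁻ (T? ∘ isS q) {xs = units} s∈R)
      ... | inj₂ s∈N = proj₁ (∈-filter⁻ (T? ∘ isN q) {xs = units} s∈N)

  module TwoNonResidue (2^h≈q : 2 ^ h ≈ q) where

    doubleMod : ℕ → ℕ
    doubleMod s = 2 * s % p

    p∤2 : ¬ p ∣ 2
    p∤2 = 0<∧<⇒∤ (s≤s z≤n) (s≤s 2≤q)

    doubleMod-residue : ∀ {s} → Residue s → NonResidue (doubleMod s)
    doubleMod-residue {s} res = 2s≢0 , ¬□2s
      where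
        2s≢0 : doubleMod s ≢ 0
        2s≢0 2s≡0 = ∤-* p∤2 (Residue⇒∤ res) (≈0⇒∣ (mod≡ 2s≡0))
        ¬□2s : ¬ Square (doubleMod s)
        ¬□2s □2s = 1≉q (begin
          1                  ≈⟨ euler-residue (2s≢0 , □2s) ⟨
          (2 * s % p) ^ h    ≈⟨ ^-congˡ h (%-≈ (2 * s)) ⟩
          (2 * s) ^ h        ≡⟨ ^-distribʳ-* 2 s h ⟩
          2 ^ h * s ^ h      ≈⟨ *-cong 2^h≈q (euler-residue res) ⟩
          q * 1              ≡⟨ *-identityʳ q ⟩
          q                  ∎)
          where open ≈-Reasoning

    doubleMod-injective : ∀ {s t} → s ∈ residues → t ∈ residues → doubleMod s ≡ doubleMod t → s ≡ t
    doubleMod-injective {s} {t} s∈ t∈ 2s≡2t =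
      <⇒≈⇒≡ (Square⇒< (proj₂ (∈-residues⁻ s∈))) (Square⇒< (proj₂ (∈-residues⁻ t∈)))
        (*-cancelʳ-≈ p∤2 (begin
          s * 2  ≡⟨ *-comm s 2 ⟩
          2 * s  ≈⟨ mod≡ 2s≡2t ⟩
          2 * t  ≡⟨ *-comm 2 t ⟩
          t * 2  ∎))
      where open ≈-Reasoning

    doubleMod-residues-unique : Unique (map doubleMod residues)
    doubleMod-residues-unique = Unique-map⁺ doubleMod doubleMod-injective residues-unique

    doubleMod-residues⊆nonresidues : ∀ {s} → s ∈ map doubleMod residues → s ∈ nonresidues
    doubleMod-residues⊆nonresidues s∈ with r , r∈ , refl ← ∈-map⁻ doubleMod s∈ =
      ∈-nonresidues⁺ (doubleMod-residue (∈-residues⁻ r∈)) (m%n<n (2 * r) p)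

    #residues≤#nonresidues : length residues ≤ length nonresidues
    #residues≤#nonresidues = subst (_≤ length nonresidues) (length-map doubleMod residues)
      (Unique-⊆⇒length≤ doubleMod-residues-unique doubleMod-residues⊆nonresidues)

    length-residues : length residues ≡ h
    length-residues = ≤-antisym (*-cancelˡ-≤ 2 2R≤2h) h≤#residues
      where
        open ≤-Reasoning
        2R≤2h : 2 * length residues ≤ 2 * h
        2R≤2h = begin
          2 * length residues                      ≡⟨ cong (length residues +_) (+-identityʳ _) ⟩
          length residues + length residues        ≤⟨ +-monoʳ-≤ (length residues) #residues≤#nonresidues ⟩
          length residues + length nonresidues     ≤⟨ #residues+#nonresidues≤q ⟩
          q                                        ≡⟨ q≡2h ⟩
          2 * h                                    ∎

    length-nonresidues : length nonresidues ≡ h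
    length-nonresidues =
      ≤-antisym (+-cancelˡ-≤ h _ _ h+N≤h+h) (subst (_≤ _) length-residues #residues≤#nonresidues)
      where
        open ≤-Reasoning
        h+N≤h+h : h + length nonresidues ≤ h + h
        h+N≤h+h = begin
          h + length nonresidues                ≡⟨ cong (_+ _) length-residues ⟨
          length residues + length nonresidues  ≤⟨ #residues+#nonresidues≤q ⟩
          q                                     ≡⟨ trans q≡2h (cong (h +_) (+-identityʳ h)) ⟩
          h + h                                 ∎

    doubleMod-residues↭nonresidues : map doubleMod residues ↭ nonresidues
    doubleMod-residues↭nonresidues =
      Unique-⊆⇒↭ doubleMod-residues-unique nonresidues-unique doubleMod-residues⊆nonresidues
        (≤-reflexive (trans length-nonresidues (trans (sym length-residues) (sym (length-map doubleMod residues)))))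

    euler-nonresidue : ∀ {n} → NonResidue n → n < p → n ^ h ≈ q
    euler-nonresidue nres n<p
      with n∈ ← ∈-resp-↭ (↭-sym doubleMod-residues↭nonresidues) (∈-nonresidues⁺ nres n<p)
      with s , s∈ , refl ← ∈-map⁻ doubleMod n∈ =
      begin
        (2 * s % p) ^ h    ≈⟨ ^-congˡ h (%-≈ (2 * s)) ⟩
        (2 * s) ^ h        ≡⟨ ^-distribʳ-* 2 s h ⟩
        2 ^ h * s ^ h      ≈⟨ *-cong 2^h≈q (euler-residue (∈-residues⁻ s∈)) ⟩
        q * 1              ≡⟨ *-identityʳ q ⟩
        q                  ∎
      where open ≈-Reasoning

    module MinusOneResidue {t} (h≡2t : h ≡ 2 * t) where

      minus-one-residue : Residue q
      minus-one-residue with T? (isS q q)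
      ... | yes q∈S = isS⇒Residue q∈S
      ... | no  q∉S = contradiction (≈-trans (≈-sym q^h≈1) (euler-nonresidue q-nonresidue ≤-refl)) 1≉q
        where
          open ≈-Reasoning
          q≢0 : q ≢ 0
          q≢0 q≡0 = <⇒≱ (≤-trans (s≤s z≤n) 2≤q) (≤-reflexive q≡0)
          q-nonresidue : NonResidue q
          q-nonresidue = q≢0 , q∉S ∘ Residue⇒isS ∘ (q≢0 ,_)
          q^h≈1 : q ^ h ≈ 1
          q^h≈1 = begin
            q ^ h            ≡⟨ cong (q ^_) h≡2t ⟩
            q ^ (2 * t)      ≡⟨ ^-*-assoc q 2 t ⟨
            (q ^ 2) ^ t      ≡⟨ cong (λ x → (q * x) ^ t) (*-identityʳ q) ⟩
            (q * q) ^ t      ≈⟨ ^-congˡ t (q*q≈1 (≤-trans (s≤s z≤n) 2≤q)) ⟩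
            1 ^ t            ≡⟨ ^-zeroˡ t ⟩
            1                ∎

      residue-neg : ∀ {s} → Residue s → Residue (p ∸ s)
      residue-neg {s} (s≢0 , x , refl) with i , ii≡q ← proj₂ minus-one-residue =
        m>n⇒m∸n≢0 s<p , i * x , <⇒≈⇒≡ (m%n<n (i * x * (i * x)) p) (s≤s p∸s≤q) (begin
          i * x * (i * x) % p  ≈⟨ %-≈ _ ⟩
          i * x * (i * x)      ≡⟨ interchange i x i x ⟩
          i * i * (x * x)
            ≈⟨ *-cong (≈-trans (≈-sym (%-≈ (i * i))) (≈-reflexive ii≡q)) (≈-sym (%-≈ (x * x))) ⟩
          q * s                ≡⟨ cong (q *_) (m∸[m∸n]≡n (<⇒≤ s<p)) ⟨
          q * (p ∸ (p ∸ s))    ≈⟨ q*[p∸x]≈x p∸s≤q ⟩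
          p ∸ s                ∎)
        where
          open ≈-Reasoning
          s<p : x * x % p < p
          s<p = m%n<n (x * x) p
          p∸s≤q : p ∸ (x * x % p) ≤ q
          p∸s≤q = ∸-monoʳ-≤ p (n≢0⇒n>0 s≢0)

      smallResidues largeResidues : List ℕ
      smallResidues = filter (λ s → 2 * s <? p) residues
      largeResidues = filter (λ s → ¬? (2 * s <? p)) residues

      negation-length≤ : ∀ {xs ys} → Unique xs → (∀ {s} → s ∈ xs → s ∈ residues) →
                         (∀ {s} → s ∈ xs → p ∸ s ∈ ys) → length xs ≤ length ys
      negation-length≤ {xs} {ys} !xs xs⊆residues into = subst (_≤ length ys) (length-map (p ∸_) xs)
        (Unique-⊆⇒length≤ (Unique-map⁺ (p ∸_) injective !xs) negations⊆ys)
        where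
          s≤p : ∀ {s} → s ∈ xs → s ≤ p
          s≤p s∈ = <⇒≤ (Square⇒< (proj₂ (∈-residues⁻ (xs⊆residues s∈))))
          injective : ∀ {s s′} → s ∈ xs → s′ ∈ xs → p ∸ s ≡ p ∸ s′ → s ≡ s′
          injective s∈ s′∈ = ∸-cancelˡ-≡ (s≤p s∈) (s≤p s′∈)
          negations⊆ys : ∀ {x} → x ∈ map (p ∸_) xs → x ∈ ys
          negations⊆ys x∈ with s , s∈ , refl ← ∈-map⁻ (p ∸_) x∈ = into s∈

      #smallResidues≡#largeResidues : length smallResidues ≡ length largeResidues
      #smallResidues≡#largeResidues = ≤-antisym
        (negation-length≤ (Uniqueₚ.filter⁺ _ residues-unique) (proj₁ ∘ small⇒) small↦large)
        (negation-length≤ (Uniqueₚ.filter⁺ _ residues-unique) (proj₁ ∘ large⇒) large↦small)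
        where
          small⇒ : ∀ {s} → s ∈ smallResidues → s ∈ residues × 2 * s < p
          small⇒ = ∈-filter⁻ (λ s → 2 * s <? p) {xs = residues}
          large⇒ : ∀ {s} → s ∈ largeResidues → s ∈ residues × ¬ 2 * s < p
          large⇒ = ∈-filter⁻ (λ s → ¬? (2 * s <? p)) {xs = residues}
          s≤p : ∀ {s} → s ∈ residues → s ≤ p
          s≤p s∈ = <⇒≤ (Square⇒< (proj₂ (∈-residues⁻ s∈)))
          small↦large : ∀ {s} → s ∈ smallResidues → p ∸ s ∈ largeResidues
          small↦large s∈ with s∈R , 2s<p ← small⇒ s∈ =
            ∈-filter⁺ (λ s → ¬? (2 * s <? p)) (∈-residues⁺ (residue-neg (∈-residues⁻ s∈R)))
              (λ 2[p∸s]<p → <-asym 2s<p (2[n∸m]<n⇒n<2m (s≤p s∈R) 2[p∸s]<p))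
          large↦small : ∀ {s} → s ∈ largeResidues → p ∸ s ∈ smallResidues
          large↦small {s} s∈ with s∈R , 2s≮p ← large⇒ s∈ =
            ∈-filter⁺ (λ s → 2 * s <? p) (∈-residues⁺ (residue-neg (∈-residues⁻ s∈R)))
              (n<2m⇒2[n∸m]<n (s≤p s∈R) (≤∧≢⇒< (≮⇒≥ 2s≮p) λ p≡2s → even≢odd s h (trans (sym p≡2s) (cong suc q≡2h))))

      length-smallResidues : length smallResidues ≡ t
      length-smallResidues = *-cancelˡ-≡ _ t 2 (begin
        2 * length smallResidues                     ≡⟨ cong (length smallResidues +_) (+-identityʳ _) ⟩
        length smallResidues + length smallResidues
          ≡⟨ cong (length smallResidues +_) #smallResidues≡#largeResidues ⟩
        length smallResidues + length largeResidues
          ≡⟨ length-filter+length-filter-¬ (λ s → 2 * s <? p) residues ⟩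
        length residues                              ≡⟨ length-residues ⟩
        h                                            ≡⟨ h≡2t ⟩
        2 * t                                        ∎)
        where open ≡-Reasoning

-- Trees given by a parent function

module _ {A : Set} where

  NonBacktracking : List A → Set
  NonBacktracking (x ∷ y ∷ z ∷ xs) = x ≢ z × NonBacktracking (y ∷ z ∷ xs)
  NonBacktracking _                = ⊤

  LastStep : Rel A 0ℓ → List A → Set
  LastStep R (x ∷ y ∷ [])     = R x y
  LastStep R (_ ∷ y ∷ z ∷ xs) = LastStep R (y ∷ z ∷ xs)
  LastStep R _                = ⊥

  Unique⇒NonBacktracking : ∀ {xs} → Unique xs → NonBacktracking xs
  Unique⇒NonBacktracking []                              = _
  Unique⇒NonBacktracking (_ ∷ [])                        = _
  Unique⇒NonBacktracking (_ ∷ _ ∷ [])                    = _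
  Unique⇒NonBacktracking ((_ ∷ x≢z ∷ _) ∷ !yzxs@(_ ∷ _ ∷ _)) = x≢z , Unique⇒NonBacktracking !yzxs

  closed-walk-nonBacktracking : ∀ {s rest} → 2 ≤ length rest → Unique (s ∷ rest) →
                                NonBacktracking (s ∷ rest ++ [ s ])
  closed-walk-nonBacktracking {s} {y₁ ∷ y₂ ∷ ys} _ (s∉rest@(_ ∷ s≢y₂ ∷ _) ∷ !rest) =
    s≢y₂ , Unique⇒NonBacktracking (Uniqueₚ.++⁺ !rest ([] ∷ []) λ where
      (s∈rest , here refl) → All.lookup s∉rest s∈rest refl)
  closed-walk-nonBacktracking {rest = _ ∷ []} (s≤s ()) _

  Linked⇒LastStep : ∀ {R x y xs} → Linked R (x ∷ y ∷ xs) → LastStep R (x ∷ y ∷ xs)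
  Linked⇒LastStep (r ∷ [-])       = r
  Linked⇒LastStep (_ ∷ rs@(_ ∷ _)) = Linked⇒LastStep rs

  LastStep-∷ʳ : ∀ {R} xs {y z} → LastStep R (xs ∷ʳ y ∷ʳ z) → R y z
  LastStep-∷ʳ []               r = r
  LastStep-∷ʳ (_ ∷ [])         r = r
  LastStep-∷ʳ (_ ∷ _ ∷ [])     r = r
  LastStep-∷ʳ (_ ∷ x ∷ x′ ∷ xs) r = LastStep-∷ʳ (x ∷ x′ ∷ xs) r

  Linked-irreflexive : ∀ {R : Rel A 0ℓ} {x xs} → Transitive R → Irreflexive _≡_ R →
                       Linked R (x ∷ xs) → x ∉ xs
  Linked-irreflexive {R} trans irrefl rs x∈xs with Rx ∷ _ ← Linked⇒AllPairs {R = R} trans rs =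
    irrefl refl (All.lookup Rx x∈xs)

module ParentGraph {n : ℕ} (parent : Fin (suc n) → Fin (suc n)) where

  nonRoots : List (Fin (suc n))
  nonRoots = tabulate suc

  edge : Fin (suc n) → Fin (suc n) × Fin (suc n)
  edge v = parent v , v

  graph : Graph
  graph = mkGraph (suc n) (map edge nonRoots)

  ∈-nonRoots⁺ : ∀ {v} → v ≢ zero → v ∈ nonRoots
  ∈-nonRoots⁺ {zero}  v≢0 = contradiction refl v≢0
  ∈-nonRoots⁺ {suc i} _   = ∈-tabulate⁺ i

  ∈-nonRoots⁻ : ∀ {v} → v ∈ nonRoots → v ≢ zero
  ∈-nonRoots⁻ v∈ with _ , refl ← ∈-tabulate⁻ v∈ = λ ()

  nonRoots-unique : Unique nonRoots
  nonRoots-unique = Uniqueₚ.tabulate⁺ Finₚ.suc-injective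

  ∈-edges⁺ : ∀ {v} → v ≢ zero → (parent v , v) ∈ E graph
  ∈-edges⁺ = ∈-map⁺ edge ∘ ∈-nonRoots⁺

  ∈-edges⁻ : ∀ {u v} → (u , v) ∈ E graph → v ≢ zero × u ≡ parent v
  ∈-edges⁻ e∈ with v , v∈ , refl ← ∈-map⁻ edge e∈ = ∈-nonRoots⁻ v∈ , refl

  children-≡ : ∀ u → children graph u ≡ filter (λ w → parent w Fin.≟ u) nonRoots
  children-≡ u = begin
    map proj₂ (filter (λ e → proj₁ e Fin.≟ u) (map edge nonRoots))
      ≡⟨ cong (map proj₂) (filter-map (λ e → proj₁ e Fin.≟ u) edge nonRoots) ⟩
    map proj₂ (map edge (filter (λ w → parent w Fin.≟ u) nonRoots))  ≡⟨ map-∘ _ ⟨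
    map id (filter (λ w → parent w Fin.≟ u) nonRoots)                ≡⟨ map-id _ ⟩
    filter (λ w → parent w Fin.≟ u) nonRoots                         ∎
    where open ≡-Reasoning

  Down : Fin (suc n) → Fin (suc n) → Set
  Down u v = (u , v) ∈ E graph

  descends : ∀ {x y} ws → Down x y → Linked (Adj graph) (y ∷ ws) → NonBacktracking (x ∷ y ∷ ws) →
             Linked Down (x ∷ y ∷ ws)
  descends []       d _             _         = d ∷ [-]
  descends (z ∷ ws) d (inj₁ d′ ∷ l) (_ , nb)  = d ∷ descends ws d′ l nb
  descends (z ∷ ws) d (inj₂ u ∷ _)  (x≢z , _) =
    contradiction (trans (proj₂ (∈-edges⁻ d)) (sym (proj₂ (∈-edges⁻ u)))) x≢z

  ascends-or-ends-down : ∀ {x y} ws → Linked (Adj graph) (x ∷ y ∷ ws) → NonBacktracking (x ∷ y ∷ ws) →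
                        Linked (flip Down) (x ∷ y ∷ ws) ⊎ LastStep Down (x ∷ y ∷ ws)
  ascends-or-ends-down []       (inj₁ d ∷ [-]) _        = inj₂ d
  ascends-or-ends-down []       (inj₂ u ∷ [-]) _        = inj₁ (u ∷ [-])
  ascends-or-ends-down (z ∷ ws) (inj₁ d ∷ l)   nb       = inj₂ (Linked⇒LastStep (descends (z ∷ ws) d l nb))
  ascends-or-ends-down (z ∷ ws) (inj₂ u ∷ l)   (_ , nb) = Sum.map₁ (u ∷_) (ascends-or-ends-down ws l nb)

  module Ranked (rank : Fin (suc n) → ℕ) (rank-parent : ∀ v → v ≢ zero → rank (parent v) < rank v) where

    rank-edge : ∀ {u v} → (u , v) ∈ E graph → rank u < rank v
    rank-edge e∈ with v≢0 , refl ← ∈-edges⁻ e∈ = rank-parent _ v≢0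

    ¬mutual-parents : ∀ {v w} → v ≢ zero → w ≢ zero → parent v ≡ w → parent w ≢ v
    ¬mutual-parents {v} {w} v≢0 w≢0 refl pw≡v =
      <-asym (rank-parent v v≢0) (subst (λ u → rank u < rank w) pw≡v (rank-parent w w≢0))

    simple : IsSimple graph
    simple = Allₚ.map⁺ (Allₚ.tabulate⁺ λ i loop → <-irrefl (cong rank loop) (rank-parent (suc i) λ ()))
           , AllPairsₚ.map⁺ (AllPairsₚ.tabulate⁺ λ i≢j →
               (i≢j ∘ Finₚ.suc-injective ∘ cong proj₂)
             , λ e → ¬mutual-parents (λ ()) (λ ()) (cong proj₁ e) (sym (cong proj₂ e)))

    toRoot : ∀ k v → rank v < k → Star (Adj graph) v zero
    toRoot k       zero    _      = ε
    toRoot (suc k) (suc i) r<1+k  =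
      inj₂ (∈-edges⁺ λ ()) ◅ toRoot k (parent (suc i)) (<-≤-trans (rank-parent (suc i) λ ()) (s≤s⁻¹ r<1+k))

    connected : Connected graph
    connected u v = toRoot _ u ≤-refl ◅◅ reverse Sum.swap (toRoot _ v ≤-refl)

    descent-never-returns : ∀ {x xs} → Linked Down (x ∷ xs) → x ∉ xs
    descent-never-returns =
      Linked-irreflexive {R = λ u v → rank u < rank v} <-trans (λ u≡v → <-irrefl (cong rank u≡v))
      ∘ Linked.map rank-edge

    ascent-never-returns : ∀ {x xs} → Linked (flip Down) (x ∷ xs) → x ∉ xs
    ascent-never-returns =
      Linked-irreflexive {R = λ u v → rank v < rank u} (flip <-trans) (λ u≡v → <-irrefl (cong rank (sym u≡v)))
      ∘ Linked.map rank-edge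

    -- Once a non-backtracking walk steps down to a child it keeps stepping down, so a closed one would have to
    -- leave its start s upwards and return from above, passing through parent s at both ends.
    no-closed-walk : ∀ s rest → 2 ≤ length rest → Unique (s ∷ rest) → NonBacktracking (s ∷ rest ++ [ s ]) →
                   Linked (Adj graph) (s ∷ rest ++ [ s ]) → ⊥
    no-closed-walk s (y₁ ∷ rest) long !walk nb walk with initLast rest
    no-closed-walk s (y₁ ∷ .[]) (s≤s ()) _ _ _ | []
    no-closed-walk s (y₁ ∷ .(init ∷ʳ yₖ)) _ (_ ∷ y₁∉ ∷ _) nb (inj₁ d ∷ walk) | init ∷ʳ′ yₖ =
      descent-never-returns (descends _ d walk nb) (∈-++⁺ʳ (y₁ ∷ init ∷ʳ yₖ) (here refl))
    no-closed-walk s (y₁ ∷ .(init ∷ʳ yₖ)) _ (_ ∷ y₁∉ ∷ _) nb (inj₂ u ∷ walk) | init ∷ʳ′ yₖ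
      with ascends-or-ends-down _ (inj₂ u ∷ walk) nb
    ... | inj₁ ascent = ascent-never-returns ascent (∈-++⁺ʳ (y₁ ∷ init ∷ʳ yₖ) (here refl))
    ... | inj₂ last   = All.lookup y₁∉ (∈-++⁺ʳ init (here refl)) (trans (proj₂ (∈-edges⁻ u)) (sym yₖ≡parent-s))
      where
        yₖ≡parent-s : yₖ ≡ parent s
        yₖ≡parent-s = proj₂ (∈-edges⁻ (LastStep-∷ʳ (s ∷ y₁ ∷ init) last))

    acyclic : Acyclic graph
    acyclic c = no-closed-walk start rest long distinct (closed-walk-nonBacktracking long distinct) closed
      where open Cycle c

    isTree : IsTree graph
    isTree = simple , connected , acyclic

module _ (G : Graph) where

  Separates : (Fin (V G) → ℕ) → ℕ → Set
  Separates b x = ∀ u v → Adj G u v → (b u ≤ x × x < b v) ⊎ (b v ≤ x × x < b u)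

  complement : (Fin (V G) → ℕ) → Fin (V G) → ℕ
  complement b v = #E G ∸ b v

  complement-β : ∀ {b} → IsBetaValuation G b → IsBetaValuation G (complement b)
  complement-β {b} (injective , bounded , diffs) =
      (λ {u} {v} → injective ∘ ∸-cancelˡ-≡ (bounded u) (bounded v))
    , (λ v → m∸n≤m (#E G) (b v))
    , subst (_↭ _) (sym (map-cong (λ (u , v) → ∣N∸a-N∸c∣≡∣a-c∣ (bounded u) (bounded v)) (E G))) diffs

  complement-separates : ∀ {b x} → (∀ v → b v ≤ #E G) → Separates b x →
                         Separates (complement b) (#E G ∸ suc x)
  complement-separates {b} {x} bounded sep u v uv with sep u v uv
  ... | inj₁ (bu≤x , x<bv) =
    inj₂ (∸-monoʳ-≤ (#E G) x<bv , ∸-monoʳ-< (s≤s bu≤x) (≤-trans x<bv (bounded v)))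
  ... | inj₂ (bv≤x , x<bu) =
    inj₁ (∸-monoʳ-≤ (#E G) x<bu , ∸-monoʳ-< (s≤s bv≤x) (≤-trans x<bu (bounded u)))

  alpha-with-low-vertex : ∀ {b} r → IsAlphaValuation G b →
    Σ (Fin (V G) → ℕ) λ b′ → Σ ℕ λ x → IsBetaValuation G b′ × Separates b′ x × b′ r ≤ x
  alpha-with-low-vertex {b} r (β , x , _ , sep) with b r ≤? x
  ... | yes br≤x = b , x , β , sep , br≤x
  ... | no  br≰x = complement b , #E G ∸ suc x , complement-β β , complement-separates (proj₁ (proj₂ β)) sep
                   , ∸-monoʳ-≤ (#E G) (≰⇒> br≰x)

-- Rooted trees of depth two

ChildCounts : (G : Graph) → Fin (V G) → ℕ → ℕ → Set
ChildCounts G r a b = #children G r ≡ a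
                    × length (filter (λ v → #children G v ≟ 1) (children G r)) ≡ b
                    × (∀ v → v ∈ children G r → #children G v ≡ 1 ⊎ #children G v ≡ 0)

module DepthTwo {n : ℕ} (parent : Fin (suc n) → Fin (suc n)) (parent² : ∀ v → parent (parent v) ≡ zero) where

  open ParentGraph parent public

  Child Grandchild : Fin (suc n) → Set
  Child      v = v ≢ zero × parent v ≡ zero
  Grandchild v = v ≢ zero × parent v ≢ zero

  data Depth (v : Fin (suc n)) : Set where
    root       : v ≡ zero → Depth v
    child      : Child v → Depth v
    grandchild : Grandchild v → Depth v

  depth : ∀ v → Depth v
  depth zero    = root refl
  depth (suc i) with parent (suc i) Fin.≟ zero
  ... | yes p≡0 = child ((λ ()) , p≡0)
  ... | no  p≢0 = grandchild ((λ ()) , p≢0)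

  grandchild⇒child-parent : ∀ {v} → Grandchild v → Child (parent v)
  grandchild⇒child-parent {v} (_ , p≢0) = p≢0 , parent² v

  rank : Fin (suc n) → ℕ
  rank v with depth v
  ... | root _       = 0
  ... | child _      = 1
  ... | grandchild _ = 2

  rank-child : ∀ {v} → Child v → rank v ≡ 1
  rank-child {v} (v≢0 , p≡0) with depth v
  ... | root v≡0              = contradiction v≡0 v≢0
  ... | child _               = refl
  ... | grandchild (_ , p≢0)  = contradiction p≡0 p≢0

  rank-grandchild : ∀ {v} → Grandchild v → rank v ≡ 2
  rank-grandchild {v} (v≢0 , p≢0) with depth v
  ... | root v≡0            = contradiction v≡0 v≢0
  ... | child (_ , p≡0)     = contradiction p≡0 p≢0
  ... | grandchild _        = refl

  rank-parent : ∀ v → v ≢ zero → rank (parent v) < rank v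
  rank-parent v v≢0 with depth v
  ... | root v≡0        = contradiction v≡0 v≢0
  ... | child (_ , p≡0) = subst (λ u → rank u < 1) (sym p≡0) (s≤s z≤n)
  ... | grandchild gv   = subst (_< 2) (sym (rank-child (grandchild⇒child-parent gv))) ≤-refl

  open Ranked rank rank-parent public using (isTree)

  edge-depths : ∀ {u v} → (u , v) ∈ E graph →
                (u ≡ zero × Child v) ⊎ (Child u × Grandchild v × u ≡ parent v)
  edge-depths {u} {v} uv∈E with v≢0 , u≡pv ← ∈-edges⁻ uv∈E | depth v
  ... | root v≡0                = contradiction v≡0 v≢0
  ... | child cv@(_ , pv≡0)     = inj₁ (trans u≡pv pv≡0 , cv)
  ... | grandchild gv           = inj₂ (subst Child (sym u≡pv) (grandchild⇒child-parent gv) , gv , u≡pv)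

  small : Fin (suc n) → Bool
  small v = not (rank v ≡ᵇ 1)

  nearAlpha : ∀ {b} → IsBetaValuation graph b →
              (∀ {v} → Child v → b zero < b v) → (∀ {v} → Grandchild v → b v < b (parent v)) →
              IsNearAlphaValuation graph b
  nearAlpha {b} β root< grandchild< = β , small , λ where
      v u (inj₁ vu∈E) → down (edge-depths vu∈E)
      v u (inj₂ uv∈E) → up (edge-depths uv∈E)
    where
      small-child : ∀ {v} → Child v → small v ≡ false
      small-child cv = cong (λ k → not (k ≡ᵇ 1)) (rank-child cv)
      small-grandchild : ∀ {v} → Grandchild v → small v ≡ true
      small-grandchild gv = cong (λ k → not (k ≡ᵇ 1)) (rank-grandchild gv)
      down : ∀ {v u} → (v ≡ zero × Child u) ⊎ (Child v × Grandchild u × v ≡ parent u) →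
             (small v ≡ true → b v < b u) × (small v ≡ false → b u < b v)
      down (inj₁ (refl , cu))      = (λ _ → root< cu) , λ ()
      down (inj₂ (cv , gu , refl)) = (λ sv → contradiction (trans (sym sv) (small-child cv)) λ ())
                                   , λ _ → grandchild< gu
      up : ∀ {v u} → (u ≡ zero × Child v) ⊎ (Child u × Grandchild v × u ≡ parent v) →
           (small v ≡ true → b v < b u) × (small v ≡ false → b u < b v)
      up (inj₁ (refl , cv))      = (λ sv → contradiction (trans (sym sv) (small-child cv)) λ ()) , λ _ → root< cv
      up (inj₂ (cu , gv , refl)) = (λ _ → grandchild< gv)
                                 , λ sv → contradiction (trans (sym (small-grandchild gv)) sv) λ ()

  grandchildren : List (Fin (suc n))
  grandchildren = filter (λ v → ¬? (parent v Fin.≟ zero)) nonRoots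

  ∈-grandchildren⁺ : ∀ {v} → Grandchild v → v ∈ grandchildren
  ∈-grandchildren⁺ (v≢0 , p≢0) = ∈-filter⁺ (λ v → ¬? (parent v Fin.≟ zero)) (∈-nonRoots⁺ v≢0) p≢0

  ∈-grandchildren⁻ : ∀ {v} → v ∈ grandchildren → Grandchild v
  ∈-grandchildren⁻ v∈ with v∈nonRoots , p≢0 ← ∈-filter⁻ (λ v → ¬? (parent v Fin.≟ zero)) {xs = nonRoots} v∈ =
    ∈-nonRoots⁻ v∈nonRoots , p≢0

  grandchildren-unique : Unique grandchildren
  grandchildren-unique = Uniqueₚ.filter⁺ _ nonRoots-unique

  #E≡n : #E graph ≡ n
  #E≡n = trans (length-map edge nonRoots) (length-tabulate suc)

  #grandchildren≤n : length grandchildren ≤ n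
  #grandchildren≤n = subst (length grandchildren ≤_) (length-tabulate suc) (length-filter _ nonRoots)

  module ParentInjective
           (parent-injective : ∀ {v w} → Grandchild v → Grandchild w → parent v ≡ parent w → v ≡ w) where

    module LowRoot (3≤#grandchildren : 3 ≤ length grandchildren)
                   {b : Fin (suc n) → ℕ} {x : ℕ} (β : IsBetaValuation graph b) (sep : Separates graph b x)
                   (r≤x : b zero ≤ x) where

      private
        2≤n : 2 ≤ n
        2≤n = ≤-trans (s≤s (s≤s z≤n)) (≤-trans 3≤#grandchildren #grandchildren≤n)
        1≤n : 1 ≤ n
        1≤n = ≤-trans (s≤s z≤n) 2≤n
        n≢pred[n] : n ≢ pred n
        n≢pred[n] n≡pred[n] = <-irrefl (sym (trans (suc-pred-of-positive 1≤n) n≡pred[n])) ≤-refl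
        r : ℕ
        r = b zero
        b-injective : ∀ {u v} → b u ≡ b v → u ≡ v
        b-injective = proj₁ β
        bounded : ∀ v → b v ≤ n
        bounded v = subst (b v ≤_) #E≡n (proj₁ (proj₂ β) v)
        diffs : edgeDiffs graph b ↭ map suc (upTo n)
        diffs = subst (λ m → edgeDiffs graph b ↭ map suc (upTo m)) #E≡n (proj₂ (proj₂ β))

      child-high : ∀ {v} → Child v → x < b v
      child-high {v} (v≢0 , p≡0) with sep zero v (inj₁ (subst (λ u → (u , v) ∈ E graph) p≡0 (∈-edges⁺ v≢0)))
      ... | inj₁ (_ , x<bv) = x<bv
      ... | inj₂ (_ , x<r)  = contradiction r≤x (<⇒≱ x<r)

      grandchild-low : ∀ {v} → Grandchild v → b v ≤ x
      grandchild-low {v} gv@(v≢0 , _) with sep (parent v) v (inj₁ (∈-edges⁺ v≢0))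
      ... | inj₁ (bp≤x , _) = contradiction bp≤x (<⇒≱ (child-high (grandchild⇒child-parent gv)))
      ... | inj₂ (bv≤x , _) = bv≤x

      data EdgeWithDifference (d : ℕ) : Set where
        rootEdge : ∀ {w} → Child w → r + d ≡ b w → EdgeWithDifference d
        leafEdge : ∀ {w} → Grandchild w → b w + d ≡ b (parent w) → EdgeWithDifference d

      edge-with-difference : ∀ d → 1 ≤ d → d ≤ n → EdgeWithDifference d
      edge-with-difference (suc d) _ d<n
        with (u , w) , uw∈E , d≡ ← ∈-map⁻ _ (∈-resp-↭ (↭-sym diffs) (∈-map⁺ suc (∈-upTo⁺ d<n)))
        with edge-depths uw∈E
      ... | inj₁ (refl , cw) = rootEdge cw (∣-∣≡⇒+≡ (≤-trans r≤x (<⇒≤ (child-high cw))) (sym d≡))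
      ... | inj₂ (_ , gw , refl) =
        leafEdge gw (∣-∣≡⇒+≡ (<⇒≤ (≤-<-trans (grandchild-low gw) (child-high (grandchild⇒child-parent gw))))
                             (trans (∣-∣-comm (b w) _) (sym d≡)))

      same-leaf : ∀ {w w′} → Grandchild w → Grandchild w′ →
                  b w ≡ b w′ ⊎ b (parent w) ≡ b (parent w′) → w ≡ w′
      same-leaf _  _   (inj₁ bw≡bw′) = b-injective bw≡bw′
      same-leaf gw gw′ (inj₂ bp≡bp′) = parent-injective gw gw′ (b-injective bp≡bp′)

      leaf-edges-sharing-a-label : ∀ {w w′ d d′} → Grandchild w → Grandchild w′ →
                                   b w + d ≡ b (parent w) → b w′ + d′ ≡ b (parent w′) →
                                   b w ≡ b w′ ⊎ b (parent w) ≡ b (parent w′) → d ≡ d′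
      leaf-edges-sharing-a-label gw gw′ e e′ shared with refl ← same-leaf gw gw′ shared =
        +-cancelˡ-≡ _ _ _ (trans e (sym e′))

      root-above-one : 2 ≤ r → ⊥
      root-above-one 2≤r with edge-with-difference n 1≤n ≤-refl
      ... | rootEdge {w} _ r+n≡bw = <⇒≱ (m<n+m n (≤-trans (s≤s z≤n) 2≤r)) (subst (_≤ n) (sym r+n≡bw) (bounded w))
      ... | leafEdge {w} gw bw+n≡bp with edge-with-difference (pred n) (pred-positive 2≤n) pred[n]≤n
      ...   | rootEdge {w′} _ r+n∸1≡bw′ = <⇒≱ n<r+pred[n] (subst (_≤ n) (sym r+n∸1≡bw′) (bounded w′))
        where
          n<r+pred[n] : n < r + pred n
          n<r+pred[n] = subst (_< r + pred n) (suc-pred-of-positive 1≤n) (+-monoˡ-≤ (pred n) 2≤r)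
      ...   | leafEdge {w′} gw′ bw′+n∸1≡bp′ =
              n≢pred[n] (leaf-edges-sharing-a-label gw gw′ bw+n≡bp bw′+n∸1≡bp′ shared)
        where
          bw≡0 : b w ≡ 0
          bw≡0 = m+n≤n⇒m≡0 (subst (_≤ n) (sym bw+n≡bp) (bounded (parent w)))
          bw′+n∸1≤1+n∸1 : b w′ + pred n ≤ 1 + pred n
          bw′+n∸1≤1+n∸1 = subst₂ _≤_ (sym bw′+n∸1≡bp′) (sym (suc-pred-of-positive 1≤n)) (bounded (parent w′))
          shared : b w ≡ b w′ ⊎ b (parent w) ≡ b (parent w′)
          shared with ≤1⇒≡0⊎≡1 (+-cancelʳ-≤ (pred n) (b w′) 1 bw′+n∸1≤1+n∸1)
          ... | inj₁ bw′≡0 = inj₁ (trans bw≡0 (sym bw′≡0))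
          ... | inj₂ bw′≡1 = inj₂ (begin
            b (parent w)   ≡⟨ bw+n≡bp ⟨
            b w + n        ≡⟨ cong (_+ n) bw≡0 ⟩
            n              ≡⟨ suc-pred-of-positive 1≤n ⟨
            1 + pred n     ≡⟨ cong (_+ pred n) bw′≡1 ⟨
            b w′ + pred n  ≡⟨ bw′+n∸1≡bp′ ⟩
            b (parent w′)  ∎)
            where open ≡-Reasoning

      root-far-below-threshold : r + 2 ≤ x → ⊥
      root-far-below-threshold r+2≤x with edge-with-difference 1 (s≤s z≤n) 1≤n
      ... | rootEdge cw r+1≡bw = <⇒≱ (child-high cw) (subst (_≤ x) r+1≡bw (≤-trans (+-monoʳ-≤ r (n≤1+n 1)) r+2≤x))
      ... | leafEdge {w} gw bw+1≡bp with edge-with-difference 2 (s≤s z≤n) 2≤n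
      ...   | rootEdge cw′ r+2≡bw′ = <⇒≱ (child-high cw′) (subst (_≤ x) r+2≡bw′ r+2≤x)
      ...   | leafEdge {w′} gw′ bw′+2≡bp′ =
              contradiction (leaf-edges-sharing-a-label gw′ gw bw′+2≡bp′ bw+1≡bp shared) λ ()
        where
          x<bp : ∀ {v} → Grandchild v → x < b (parent v)
          x<bp gv = child-high (grandchild⇒child-parent gv)
          bw≡x : b w ≡ x
          bw≡x = ≤∧<+1⇒≡ (grandchild-low gw) (subst (x <_) (sym bw+1≡bp) (x<bp gw))
          shared : b w′ ≡ b w ⊎ b (parent w′) ≡ b (parent w)
          shared with ≤∧<+2⇒≡⊎≡ (grandchild-low gw′) (subst (x <_) (sym bw′+2≡bp′) (x<bp gw′))
          ... | inj₁ bw′≡x   = inj₁ (trans bw′≡x (sym bw≡x))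
          ... | inj₂ 1+bw′≡x = inj₂ (begin
            b (parent w′)  ≡⟨ bw′+2≡bp′ ⟨
            b w′ + 2       ≡⟨ +-suc (b w′) 1 ⟩
            suc (b w′) + 1 ≡⟨ cong (_+ 1) (trans 1+bw′≡x (sym bw≡x)) ⟩
            b w + 1        ≡⟨ bw+1≡bp ⟩
            b (parent w)   ∎)
            where open ≡-Reasoning

      #grandchildren≤threshold : length grandchildren ≤ x
      #grandchildren≤threshold = s≤s⁻¹ (begin
        suc (length grandchildren)             ≡⟨ length-map b (zero ∷ grandchildren) ⟨
        length (map b (zero ∷ grandchildren))  ≤⟨ Unique-⊆⇒length≤ unique into ⟩
        length (upTo (suc x))                  ≡⟨ length-upTo (suc x) ⟩
        suc x                                  ∎)
        where
          open ≤-Reasoning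
          unique : Unique (map b (zero ∷ grandchildren))
          unique = Unique-map⁺ b (λ _ _ → b-injective)
                     (All.tabulate (λ v∈ → ≢-sym (proj₁ (∈-grandchildren⁻ v∈))) ∷ grandchildren-unique)
          into : ∀ {k} → k ∈ map b (zero ∷ grandchildren) → k ∈ upTo (suc x)
          into k∈ with v , v∈ , refl ← ∈-map⁻ b k∈ with v∈
          ... | here refl = ∈-upTo⁺ (s≤s r≤x)
          ... | there v∈grandchildren = ∈-upTo⁺ (s≤s (grandchild-low (∈-grandchildren⁻ v∈grandchildren)))

      -- If the root label r is at least 2, the edges with differences n and n ∸ 1 are leaf edges sharing the
      -- label 0 or n. If r + 2 ≤ x, the edges with differences 1 and 2 are leaf edges sharing the label x or
      -- x + 1. Otherwise the root and all grandchildren carry distinct labels ≤ x ≤ 2.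
      impossible : ⊥
      impossible with 2 ≤? r | r + 2 ≤? x
      ... | yes 2≤r | _         = root-above-one 2≤r
      ... | no  _   | yes r+2≤x = root-far-below-threshold r+2≤x
      ... | no  2≰r | no  r+2≰x =
        <⇒≱ (≤-<-trans (≤-trans 3≤#grandchildren #grandchildren≤threshold) (≰⇒> r+2≰x))
            (+-monoˡ-≤ 2 (s≤s⁻¹ (≰⇒> 2≰r)))

    noAlpha : 3 ≤ length grandchildren → ∀ b → ¬ IsAlphaValuation graph b
    noAlpha 3≤#grandchildren b α with _ , _ , β , sep , low ← alpha-with-low-vertex graph zero α =
      LowRoot.impossible 3≤#grandchildren β sep low

    ∈-children⁺ : ∀ {u w} → w ≢ zero → parent w ≡ u → w ∈ children graph u
    ∈-children⁺ {u} w≢0 pw≡u =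
      subst (_ ∈_) (sym (children-≡ u)) (∈-filter⁺ (λ w → parent w Fin.≟ u) (∈-nonRoots⁺ w≢0) pw≡u)

    ∈-children⁻ : ∀ {u w} → w ∈ children graph u → w ≢ zero × parent w ≡ u
    ∈-children⁻ {u} w∈
      with w∈nonRoots , pw≡u ← ∈-filter⁻ (λ w → parent w Fin.≟ u) {xs = nonRoots} (subst (_ ∈_) (children-≡ u) w∈) =
      ∈-nonRoots⁻ w∈nonRoots , pw≡u

    ∈-children⇒grandchild : ∀ {v w} → v ≢ zero → w ∈ children graph v → Grandchild w
    ∈-children⇒grandchild v≢0 w∈ with w≢0 , pw≡v ← ∈-children⁻ w∈ = w≢0 , λ pw≡0 → v≢0 (trans (sym pw≡v) pw≡0)

    children-unique : ∀ u → Unique (children graph u)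
    children-unique u = subst Unique (sym (children-≡ u)) (Uniqueₚ.filter⁺ _ nonRoots-unique)

    #children≤1 : ∀ {v} → v ≢ zero → #children graph v ≡ 1 ⊎ #children graph v ≡ 0
    #children≤1 v≢0 = Unique-all-equal⇒length≤1 (children-unique _) λ w∈ w′∈ →
      parent-injective (∈-children⇒grandchild v≢0 w∈) (∈-children⇒grandchild v≢0 w′∈)
                       (trans (proj₂ (∈-children⁻ w∈)) (sym (proj₂ (∈-children⁻ w′∈))))

    #children[root]+#grandchildren≡n : #children graph zero + length grandchildren ≡ n
    #children[root]+#grandchildren≡n = begin
      #children graph zero + length grandchildren
        ≡⟨ cong (λ cs → length cs + length grandchildren) (children-≡ zero) ⟩
      length (filter (λ w → parent w Fin.≟ zero) nonRoots) + length grandchildren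
        ≡⟨ length-filter+length-filter-¬ (λ w → parent w Fin.≟ zero) nonRoots ⟩
      length nonRoots
        ≡⟨ length-tabulate suc ⟩
      n ∎
      where open ≡-Reasoning

    #root-children-with-one-child :
      length (filter (λ v → #children graph v ≟ 1) (children graph zero)) ≡ length grandchildren
    #root-children-with-one-child =
      trans (Unique-⊆-⊇⇒length≡ (Uniqueₚ.filter⁺ _ (children-unique zero)) parents-unique into onto)
            (length-map parent grandchildren)
      where
        parents-unique : Unique (map parent grandchildren)
        parents-unique = Unique-map⁺ parent (λ w∈ w′∈ → parent-injective (∈-grandchildren⁻ w∈) (∈-grandchildren⁻ w′∈))
                                     grandchildren-unique
        into : ∀ {v} → v ∈ filter (λ v → #children graph v ≟ 1) (children graph zero) → v ∈ map parent grandchildren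
        into v∈ with v∈children , #≡1 ← ∈-filter⁻ (λ v → #children graph v ≟ 1) {xs = children graph zero} v∈
                with w , w∈ ← length≡suc⇒∈ #≡1 =
          subst (_∈ map parent grandchildren) (proj₂ (∈-children⁻ w∈))
            (∈-map⁺ parent (∈-grandchildren⁺ (∈-children⇒grandchild (proj₁ (∈-children⁻ v∈children)) w∈)))
        onto : ∀ {v} → v ∈ map parent grandchildren → v ∈ filter (λ v → #children graph v ≟ 1) (children graph zero)
        onto v∈ with w , w∈ , refl ← ∈-map⁻ parent v∈ =
          let w≢0 , pw≢0 = ∈-grandchildren⁻ w∈ in
          ∈-filter⁺ (λ v → #children graph v ≟ 1) (∈-children⁺ pw≢0 (parent² w)) (#≡1 w≢0 pw≢0)
          where
            #≡1 : ∀ {w} → w ≢ zero → parent w ≢ zero → #children graph (parent w) ≡ 1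
            #≡1 {w} w≢0 pw≢0 with #children≤1 pw≢0
            ... | inj₁ #≡1 = #≡1
            ... | inj₂ #≡0 = contradiction #≡0 (∈⇒length≢0 (∈-children⁺ {parent w} w≢0 refl))

    root-child-counts : ChildCounts graph zero (n ∸ length grandchildren) (length grandchildren)
    root-child-counts =
        trans (sym (m+n∸n≡m _ (length grandchildren)))
              (cong (_∸ length grandchildren) #children[root]+#grandchildren≡n)
      , #root-children-with-one-child
      , λ v v∈ → #children≤1 (proj₁ (∈-children⁻ v∈))

module TheTree (q : ℕ) where

  open Congruence q using (p)

  -- These repeat the local definitions in T (suc q), so that E (T p) unfolds to concatMap edgesAt (allFin p).
  level1 level2 : ℕ → Bool
  level1 s = isN q s ∨ (isS q s ∧ (p <ᵇ (2 * s)))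
  level2 s = isS q s ∧ ((2 * s) <ᵇ p)

  double : Fin p → Fin p
  double v = fromℕ< (m%n<n (2 * toℕ v) p)

  parent : Fin p → Fin p
  parent v = if level1 (toℕ v) then zero else double v

  edgesAt : Fin p → List (Fin p × Fin p)
  edgesAt v = if level1 (toℕ v) then [ (zero , v) ] else (if level2 (toℕ v) then [ (double v , v) ] else [])

  module _ {h} (q≡2h : q ≡ 2 * h) where

    classify : ∀ s → s ≢ 0 → level1 s ≡ true ⊎ (level1 s ≡ false × level2 s ≡ true)
    classify zero    s≢0 = contradiction refl s≢0
    classify (suc s) _   with any (λ x → x * x % p ≡ᵇ suc s) (upTo p)
    ... | false = inj₁ refl
    ... | true  with <-cmp (2 * suc s) p
    ...   | tri< 2s<p _ p≮2s = inj₂ (≮⇒<ᵇ≡false p≮2s , <⇒<ᵇ≡true 2s<p)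
    ...   | tri≈ _ 2s≡p _ = contradiction (trans 2s≡p (cong suc q≡2h)) (even≢odd (suc s) h)
    ...   | tri> _ _ p<2s = inj₁ (<⇒<ᵇ≡true p<2s)

    edgesAt-nonzero : ∀ v → toℕ v ≢ 0 → edgesAt v ≡ [ (parent v , v) ]
    edgesAt-nonzero v v≢0 with level1 (toℕ v) | level2 (toℕ v) | classify (toℕ v) v≢0
    ... | true  | _    | _ = refl
    ... | false | true | _ = refl
    ... | false | false | inj₂ (_ , ())

    edges≡ : E (T p) ≡ E (ParentGraph.graph parent)
    edges≡ = concatMap-singleton (Allₚ.tabulate⁺ λ i → edgesAt-nonzero (suc i) λ ())

  module Properties (isPrime : Prime p) {h} (q≡2h : q ≡ 2 * h) (2^h≈q : Congruence._≈_ q (2 ^ h) q) where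

    open QuadraticResidues q isPrime {h} q≡2h hiding (p)
    open TwoNonResidue 2^h≈q

    level2⇒residue : ∀ {s} → level2 s ≡ true → Residue s × 2 * s < p
    level2⇒residue {s} l2 with isS q s in isS≡ | 2 * s <ᵇ p in lt≡
    ... | true | true = isS⇒Residue (subst Bool.T (sym isS≡) _) , <ᵇ≡true⇒< lt≡

    residue⇒level2 : ∀ {s} → Residue s → 2 * s < p → level2 s ≡ true
    residue⇒level2 {s} res 2s<p with isS q s | Residue⇒isS res
    ... | true | _ = <⇒<ᵇ≡true 2s<p

    nonresidue⇒level1 : ∀ {s} → NonResidue s → level1 s ≡ true
    nonresidue⇒level1 {s} nres with isN q s | NonResidue⇒isN nres
    ... | true | _ = refl

    level2⇒¬level1 : ∀ {s} → level2 s ≡ true → level1 s ≡ false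
    level2⇒¬level1 {suc s} l2 with any (λ x → x * x % p ≡ᵇ suc s) (upTo p)
    ... | true = ≮⇒<ᵇ≡false {p} {2 * suc s} (<⇒≯ (<ᵇ≡true⇒< {2 * suc s} {p} l2))

    toℕ-double : ∀ {v} → 2 * toℕ v < p → toℕ (double v) ≡ 2 * toℕ v
    toℕ-double 2v<p = trans (Finₚ.toℕ-fromℕ< _) (m<n⇒m%n≡m 2v<p)

    level1-double : ∀ {v} → level2 (toℕ v) ≡ true → level1 (toℕ (double v)) ≡ true
    level1-double {v} l2 =
      nonresidue⇒level1 (subst NonResidue (sym (Finₚ.toℕ-fromℕ< _))
                                 (doubleMod-residue (proj₁ (level2⇒residue {toℕ v} l2))))

    parent² : ∀ v → parent (parent v) ≡ zero
    parent² zero    = refl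
    parent² (suc i) with classify {h} q≡2h (suc (toℕ i)) (λ ())
    ... | inj₁ l1        = cong parent (if-true l1)
    ... | inj₂ (l1 , l2) = trans (cong parent (if-false l1)) (if-true (level1-double {suc i} l2))

    open DepthTwo parent parent² public

    ≢zero⇒toℕ≢0 : ∀ {v : Fin p} → v ≢ zero → toℕ v ≢ 0
    ≢zero⇒toℕ≢0 {zero}  v≢0 = contradiction refl v≢0
    ≢zero⇒toℕ≢0 {suc _} _   = λ ()

    grandchild⇒level2 : ∀ {v} → Grandchild v → level2 (toℕ v) ≡ true
    grandchild⇒level2 {v} (v≢0 , pv≢0) with classify {h} q≡2h (toℕ v) (≢zero⇒toℕ≢0 v≢0)
    ... | inj₁ l1       = contradiction (if-true l1) pv≢0
    ... | inj₂ (_ , l2) = l2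

    parent-of-level2 : ∀ {v} → level2 (toℕ v) ≡ true → toℕ (parent v) ≡ 2 * toℕ v
    parent-of-level2 {v} l2 =
      trans (cong toℕ (if-false (level2⇒¬level1 {toℕ v} l2))) (toℕ-double {v} (proj₂ (level2⇒residue {toℕ v} l2)))

    level2⇒grandchild : ∀ {v} → level2 (toℕ v) ≡ true → Grandchild v
    level2⇒grandchild {v} l2 =
      v≢0 , λ pv≡0 → ≢zero⇒toℕ≢0 v≢0 (*-cancelˡ-≡ _ 0 2 (trans (sym (parent-of-level2 {v} l2)) (cong toℕ pv≡0)))
      where
        v≢0 : v ≢ zero
        v≢0 refl = contradiction l2 λ ()

    ∣parent-v∣≡v : ∀ v → ∣ toℕ (parent v) - toℕ v ∣ ≡ toℕ v
    ∣parent-v∣≡v zero    = refl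
    ∣parent-v∣≡v (suc i) with classify {h} q≡2h (suc (toℕ i)) (λ ())
    ... | inj₁ l1       = cong (λ u → ∣ toℕ u - suc (toℕ i) ∣) (if-true l1)
    ... | inj₂ (_ , l2) = begin
      ∣ toℕ (parent (suc i)) - x ∣  ≡⟨ cong ∣_- x ∣ (parent-of-level2 {suc i} l2) ⟩
      ∣ 2 * x - x ∣                 ≡⟨ ∣-∣-comm (2 * x) x ⟩
      ∣ x - x + (x + 0) ∣           ≡⟨ ∣m-m+n∣≡n x (x + 0) ⟩
      x + 0                         ≡⟨ +-identityʳ x ⟩
      x                             ∎
      where
        open ≡-Reasoning
        x : ℕ
        x = suc (toℕ i)

    toℕ-beta : IsBetaValuation graph toℕ
    toℕ-beta = Finₚ.toℕ-injective , (λ v → subst (toℕ v ≤_) (sym #E≡n) (Finₚ.toℕ≤pred[n] v))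
         , ↭-reflexive (begin
             map (λ e → ∣ toℕ (proj₁ e) - toℕ (proj₂ e) ∣) (map edge nonRoots) ≡⟨ map-∘ nonRoots ⟨
             map (λ v → ∣ toℕ (parent v) - toℕ v ∣) nonRoots                 ≡⟨ map-cong ∣parent-v∣≡v nonRoots ⟩
             map toℕ (tabulate suc)                                          ≡⟨ map-tabulate suc toℕ ⟩
             tabulate (λ i → suc (toℕ i))                                    ≡⟨ tabulate-toℕ q suc ⟩
             applyUpTo suc q                                                 ≡⟨ map-upTo suc q ⟨
             map suc (upTo q)                                                ≡⟨ cong (λ m → map suc (upTo m)) #E≡n ⟨
             map suc (upTo (#E graph))                                       ∎)
      where open ≡-Reasoning

    toℕ-nearAlpha : IsNearAlphaValuation graph toℕ
    toℕ-nearAlpha = nearAlpha toℕ-beta (λ (v≢0 , _) → n≢0⇒n>0 (≢zero⇒toℕ≢0 v≢0)) λ {v} gv@(v≢0 , _) →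
      subst (toℕ v <_) (sym (parent-of-level2 {v} (grandchild⇒level2 {v} gv)))
        (m<m+n (toℕ v) (subst (0 <_) (sym (+-identityʳ (toℕ v))) (n≢0⇒n>0 (≢zero⇒toℕ≢0 v≢0))))

    parent-injective : ∀ {v w} → Grandchild v → Grandchild w → parent v ≡ parent w → v ≡ w
    parent-injective {v} {w} gv gw pv≡pw = Finₚ.toℕ-injective (*-cancelˡ-≡ (toℕ v) (toℕ w) 2 (begin
      2 * toℕ v        ≡⟨ parent-of-level2 {v} (grandchild⇒level2 {v} gv) ⟨
      toℕ (parent v)   ≡⟨ cong toℕ pv≡pw ⟩
      toℕ (parent w)   ≡⟨ parent-of-level2 {w} (grandchild⇒level2 {w} gw) ⟩
      2 * toℕ w        ∎))
      where open ≡-Reasoning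

    open ParentInjective parent-injective public

    3≤#grandchildren : ∀ {a b c} (a<p : a < p) (b<p : b < p) (c<p : c < p) → a ≢ b → a ≢ c → b ≢ c →
                       level2 a ≡ true → level2 b ≡ true → level2 c ≡ true → 3 ≤ length grandchildren
    3≤#grandchildren a<p b<p c<p a≢b a≢c b≢c la lb lc = Unique-⊆⇒length≤ unique into
      where
        vertex : ∀ {s} → s < p → Fin p
        vertex s<p = fromℕ< s<p
        distinct : ∀ {s t} (s<p : s < p) (t<p : t < p) → s ≢ t → vertex s<p ≢ vertex t<p
        distinct s<p t<p s≢t eq =
          s≢t (trans (sym (Finₚ.toℕ-fromℕ< s<p)) (trans (cong toℕ eq) (Finₚ.toℕ-fromℕ< t<p)))
        vertex∈grandchildren : ∀ {s} (s<p : s < p) → level2 s ≡ true → vertex s<p ∈ grandchildren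
        vertex∈grandchildren s<p ls =
          ∈-grandchildren⁺ (level2⇒grandchild (subst (λ s → level2 s ≡ true) (sym (Finₚ.toℕ-fromℕ< s<p)) ls))
        unique : Unique (vertex a<p ∷ vertex b<p ∷ vertex c<p ∷ [])
        unique = (distinct a<p b<p a≢b ∷ distinct a<p c<p a≢c ∷ []) ∷ (distinct b<p c<p b≢c ∷ []) ∷ [] ∷ []
        into : ∀ {v} → v ∈ vertex a<p ∷ vertex b<p ∷ vertex c<p ∷ [] → v ∈ grandchildren
        into (here refl)                 = vertex∈grandchildren a<p la
        into (there (here refl))         = vertex∈grandchildren b<p lb
        into (there (there (here refl))) = vertex∈grandchildren c<p lc

    module _ {t} (h≡2t : h ≡ 2 * t) where

      open MinusOneResidue {t} h≡2t

      #grandchildren≡t : length grandchildren ≡ t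
      #grandchildren≡t = begin
        length grandchildren            ≡⟨ length-map toℕ grandchildren ⟨
        length (map toℕ grandchildren)
          ≡⟨ Unique-⊆-⊇⇒length≡ unique (Uniqueₚ.filter⁺ _ residues-unique) into onto ⟩
        length smallResidues            ≡⟨ length-smallResidues ⟩
        t                               ∎
        where
          open ≡-Reasoning
          unique : Unique (map toℕ grandchildren)
          unique = Unique-map⁺ toℕ (λ _ _ → Finₚ.toℕ-injective) grandchildren-unique
          into : ∀ {s} → s ∈ map toℕ grandchildren → s ∈ smallResidues
          into s∈ with v , v∈ , refl ← ∈-map⁻ toℕ s∈ =
            let res , 2v<p = level2⇒residue (grandchild⇒level2 {v} (∈-grandchildren⁻ v∈)) in
            ∈-filter⁺ (λ s → 2 * s <? p) (∈-residues⁺ res) 2v<p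
          onto : ∀ {s} → s ∈ smallResidues → s ∈ map toℕ grandchildren
          onto {s} s∈ with s∈R , 2s<p ← ∈-filter⁻ (λ s → 2 * s <? p) {xs = residues} s∈ =
            let res = ∈-residues⁻ s∈R ; s<p = Square⇒< (proj₂ res) in
            subst (_∈ map toℕ grandchildren) (Finₚ.toℕ-fromℕ< s<p)
              (∈-map⁺ toℕ (∈-grandchildren⁺ (level2⇒grandchild {fromℕ< s<p}
                (subst (λ s → level2 s ≡ true) (sym (Finₚ.toℕ-fromℕ< s<p)) (residue⇒level2 res 2s<p)))))

    level2-square : ∀ x → 0 < x → 2 * (x * x) < p → level2 (x * x) ≡ true
    level2-square x 0<x 2xx<p = residue⇒level2 (subst Residue (m<n⇒m%n≡m xx<p) (∤⇒Residue p∤x)) 2xx<p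
      where
        xx<p : x * x < p
        xx<p = ≤-<-trans (m≤m+n (x * x) (x * x + 0)) 2xx<p
        p∤x : ¬ p ∣ x
        p∤x = 0<∧<⇒∤ 0<x (≤-<-trans (m≤m*n x x {{>-nonZero 0<x}}) xx<p)

    19≤p⇒3≤#grandchildren : 19 ≤ p → 3 ≤ length grandchildren
    19≤p⇒3≤#grandchildren 19≤p =
      3≤#grandchildren (<-≤-trans (s≤s (s≤s z≤n)) 19≤p) (<-≤-trans (m≤m+n 5 _) 19≤p) (<-≤-trans (m≤m+n 10 _) 19≤p)
        (λ ()) (λ ()) (λ ())
        (level2-square 1 (s≤s z≤n) (<-≤-trans (m≤m+n 3 _) 19≤p))
        (level2-square 2 (s≤s z≤n) (<-≤-trans (m≤m+n 9 _) 19≤p))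
        (level2-square 3 (s≤s z≤n) 19≤p)

    transport-to-T : (P : List (Fin p × Fin p) → Set) → P (E graph) → P (E (T p))
    transport-to-T P = subst P (sym (edges≡ {h} q≡2h))

    T-isTree : IsTree (T p)
    T-isTree = transport-to-T (λ es → IsTree (mkGraph p es)) isTree

    T-nearAlpha : IsNearAlphaValuation (T p) (label p)
    T-nearAlpha = transport-to-T (λ es → IsNearAlphaValuation (mkGraph p es) toℕ) toℕ-nearAlpha

    T-noAlpha : 3 ≤ length grandchildren → ∀ b → ¬ IsAlphaValuation (T p) b
    T-noAlpha 3≤#grandchildren =
      transport-to-T (λ es → ∀ b → ¬ IsAlphaValuation (mkGraph p es) b) (noAlpha 3≤#grandchildren)

    T-root-child-counts : ∀ {t} → h ≡ 2 * t → ∀ r → label p r ≡ 0 → ChildCounts (T p) r (3 * t) t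
    T-root-child-counts {t} h≡2t r r≡0 with refl ← Finₚ.toℕ-injective {i = r} {j = zero} r≡0 =
      transport-to-T (λ es → ChildCounts (mkGraph p es) zero (3 * t) t)
        (subst₂ (ChildCounts graph zero) n∸t≡3t (#grandchildren≡t {t} h≡2t) root-child-counts)
      where
        n∸t≡3t : q ∸ length grandchildren ≡ 3 * t
        n∸t≡3t = begin
          q ∸ length grandchildren  ≡⟨ cong₂ _∸_ (trans q≡2h (cong (2 *_) h≡2t)) (#grandchildren≡t {t} h≡2t) ⟩
          2 * (2 * t) ∸ t           ≡⟨ cong (_∸ t) (4t≡3t+t t) ⟩
          3 * t + t ∸ t             ≡⟨ m+n∸n≡m (3 * t) t ⟩
          3 * t                     ∎
          where
            open ≡-Reasoning
            4t≡3t+t : ∀ t → 2 * (2 * t) ≡ 3 * t + t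
            4t≡3t+t = solve-∀

mod8-classes : ∀ p → Prime p → 11 ≤ p → p % 8 ≢ 1 → p % 8 ≢ 7 →
               ∃[ k ] (p ≡ 3 + k * 8 ⊎ p ≡ 5 + k * 8)
mod8-classes p isPrime 11≤p p%8≢1 p%8≢7 = classify (p % 8) (m%n<n p 8) refl
  where
    k : ℕ
    k = p / 8

    p≡r+8k : ∀ {r} → p % 8 ≡ r → p ≡ r + k * 8
    p≡r+8k {r} p%8≡r = trans (m≡m%n+[m/n]*n p 8) (cong (_+ k * 8) p%8≡r)

    not-even : ∀ j → p % 8 ≢ 2 * j
    not-even j p%8≡2j = prime-not-even isPrime (≤-trans (s≤s (s≤s (s≤s z≤n))) 11≤p) (j + k * 4)
                          (trans (p≡r+8k p%8≡2j) (double-sum j k))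
      where
        double-sum : ∀ j k → 2 * j + k * 8 ≡ 2 * (j + k * 4)
        double-sum = solve-∀

    classify : ∀ r → r < 8 → p % 8 ≡ r → ∃[ k ] (p ≡ 3 + k * 8 ⊎ p ≡ 5 + k * 8)
    classify 0 _ p%8≡r = contradiction p%8≡r (not-even 0)
    classify 1 _ p%8≡r = contradiction p%8≡r p%8≢1
    classify 2 _ p%8≡r = contradiction p%8≡r (not-even 1)
    classify 3 _ p%8≡r = k , inj₁ (p≡r+8k p%8≡r)
    classify 4 _ p%8≡r = contradiction p%8≡r (not-even 2)
    classify 5 _ p%8≡r = k , inj₂ (p≡r+8k p%8≡r)
    classify 6 _ p%8≡r = contradiction p%8≡r (not-even 3)
    classify 7 _ p%8≡r = contradiction p%8≡r p%8≢7
    classify (suc (suc (suc (suc (suc (suc (suc (suc r)))))))) r<8 _ = contradiction r<8 (m+n≮m 8 r)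

module ThreeMod8 (k : ℕ) (isPrime : Prime (3 + k * 8)) where

  private
    q≡2h : ∀ k → 2 + k * 8 ≡ 2 * (1 + k * 4)
    q≡2h = solve-∀
    h≡m+[1+2k] : ∀ k → 1 + k * 4 ≡ k * 2 + suc (2 * k)
    h≡m+[1+2k] = solve-∀
    1+2m≡h : ∀ k → suc (2 * (k * 2)) ≡ 1 + k * 4
    1+2m≡h = solve-∀

  open TheTree (2 + k * 8) public
  open Properties isPrime {1 + k * 4} (q≡2h k)
         (PrimeModulus.gauss-two (2 + k * 8) isPrime {1 + k * 4} (q≡2h k) (k * 2) k (h≡m+[1+2k] k)
            (≤-trans (n≤1+n _) (≤-reflexive (1+2m≡h k))) (≤-reflexive (sym (1+2m≡h k)))) public

  p%8≢5 : (3 + k * 8) % 8 ≢ 5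
  p%8≢5 p%8≡5 = contradiction (trans (sym ([m+kn]%n≡m%n 3 k 8)) p%8≡5) λ ()

module FiveMod8 (k : ℕ) (isPrime : Prime (5 + k * 8)) where

  private
    q≡2h : ∀ k → 4 + k * 8 ≡ 2 * (2 + k * 4)
    q≡2h = solve-∀
    h≡m+[1+2k] : ∀ k → 2 + k * 4 ≡ (1 + k * 2) + suc (2 * k)
    h≡m+[1+2k] = solve-∀
    2m≡h : ∀ k → 2 * (1 + k * 2) ≡ 2 + k * 4
    2m≡h = solve-∀

  open TheTree (4 + k * 8) public
  open Properties isPrime {2 + k * 4} (q≡2h k)
         (PrimeModulus.gauss-two (4 + k * 8) isPrime {2 + k * 4} (q≡2h k) (1 + k * 2) k (h≡m+[1+2k] k)
            (≤-reflexive (2m≡h k)) (≤-trans (≤-reflexive (sym (2m≡h k))) (n≤1+n _))) public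

  T-root-child-counts-quarters : ∀ r → label (5 + k * 8) r ≡ 0 →
                                ChildCounts (T (5 + k * 8)) r ((3 * (4 + k * 8)) / 4) ((4 + k * 8) / 4)
  T-root-child-counts-quarters r r≡0 =
    subst₂ (ChildCounts (T (5 + k * 8)) r) (sym (3q/4≡3t k)) (sym (q/4≡t k))
           (T-root-child-counts (sym (2m≡h k)) r r≡0)
    where
      3q/4≡3t : ∀ k → (3 * (4 + k * 8)) / 4 ≡ 3 * (1 + k * 2)
      3q/4≡3t k = trans (cong (_/ 4) (distribute k)) (m*n/n≡m (3 * (1 + k * 2)) 4)
        where distribute : ∀ k → 3 * (4 + k * 8) ≡ 3 * (1 + k * 2) * 4
              distribute = solve-∀
      q/4≡t : ∀ k → (4 + k * 8) / 4 ≡ 1 + k * 2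
      q/4≡t k = trans (cong (_/ 4) (distribute k)) (m*n/n≡m (1 + k * 2) 4)
        where distribute : ∀ k → 4 + k * 8 ≡ (1 + k * 2) * 4
              distribute = solve-∀

-- 1, 4 and 9 are squares below p/2 once p ≥ 19; for p = 11 and p = 13 the square 3 takes the place of 9.
three-mod-8-grandchildren : ∀ k (isPrime : Prime (3 + k * 8)) → 11 ≤ 3 + k * 8 →
                            3 ≤ length (ThreeMod8.grandchildren k isPrime)
three-mod-8-grandchildren 0             _       (s≤s (s≤s (s≤s ())))
three-mod-8-grandchildren 1             isPrime _ =
  ThreeMod8.3≤#grandchildren 1 isPrime {1} {3} {4} (m≤m+n 2 9) (m≤m+n 4 7) (m≤m+n 5 6)
    (λ ()) (λ ()) (λ ()) refl refl refl
three-mod-8-grandchildren (suc (suc k)) isPrime _ =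
  ThreeMod8.19≤p⇒3≤#grandchildren (2 + k) isPrime (m≤m+n 19 (k * 8))

five-mod-8-grandchildren : ∀ k (isPrime : Prime (5 + k * 8)) → 11 ≤ 5 + k * 8 →
                           3 ≤ length (FiveMod8.grandchildren k isPrime)
five-mod-8-grandchildren 0             _       (s≤s (s≤s (s≤s (s≤s (s≤s ())))))
five-mod-8-grandchildren 1             isPrime _ =
  FiveMod8.3≤#grandchildren 1 isPrime {1} {3} {4} (m≤m+n 2 11) (m≤m+n 4 9) (m≤m+n 5 8)
    (λ ()) (λ ()) (λ ()) refl refl refl
five-mod-8-grandchildren (suc (suc k)) isPrime _ =
  FiveMod8.19≤p⇒3≤#grandchildren (2 + k) isPrime (m≤m+n 19 (2 + k * 8))

theorem3p11 : (p : ℕ) → Prime p → 11 ≤ p → p % 8 ≢ 1 → p % 8 ≢ 7 →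
    IsTree (T p)
    × IsNearAlphaValuation (T p) (label p)
    × (∀ b → ¬ IsAlphaValuation (T p) b)
    × (p % 8 ≡ 5 →
        ∀ r → label p r ≡ 0 →
          #children (T p) r ≡ (3 * (p ∸ 1)) / 4
          × length (filter (λ v → #children (T p) v N.≟ 1) (children (T p) r)) ≡ (p ∸ 1) / 4
          × (∀ v → v ∈ children (T p) r → #children (T p) v ≡ 1 ⊎ #children (T p) v ≡ 0))
theorem3p11 p isPrime 11≤p p%8≢1 p%8≢7 with mod8-classes p isPrime 11≤p p%8≢1 p%8≢7
... | k , inj₁ refl = let open ThreeMod8 k isPrime in
  T-isTree , T-nearAlpha , T-noAlpha (three-mod-8-grandchildren k isPrime 11≤p) , flip contradiction p%8≢5
... | k , inj₂ refl = let open FiveMod8 k isPrime in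
  T-isTree , T-nearAlpha , T-noAlpha (five-mod-8-grandchildren k isPrime 11≤p) , λ _ → T-root-child-counts-quarters
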